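{- Let $t$ be a rooted tree with at least two vertices and edge set $E(t)$. For $e\in E(t)$, removing $e$ splits $t$ into two rooted trees $t'$ and $t''$. Then \[ N(t)=\sum_{e\in E(t)}N(t')N(t''), \] where $N$ denotes the number of binary tubings. Moreover, $N(t_1)=N(t_2)$ whenever $t_1,t_2$ are rooted trees whose underlying graphs are isomorphic (differing only in the choice of root).
   Context: A tube of a rooted tree $t$ is a set of vertices inducing a connected subgraph. A binary tubing of $t$ is a set $\tau$ of tubes with $V(t)\in\tau$ such that each tube of $\tau$ is a single vertex or is partitioned by two other tubes of $\tau$. $N(t)$ is the number of binary tubings of $t$ (the one-vertex tree has $N=1$). -}

module Defs where

open import Data.Bool using (Bool; true; false; _∧_; _∨_; not)
open import Data.Nat using (ℕ; zero; suc; _+_; _≡ᵇ_)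
open import Data.Fin using (Fin; toℕ)
open import Data.Product using (_×_; _,_; proj₁; proj₂)
open import Data.List using (List; []; _∷_; _++_; map; length; allFin; [_])
open import Data.Bool.ListAction using (all; any)
open import Data.Vec using (Vec; []; _∷_; lookup; tabulate)
open import Data.Fin.Subset using (Subset; _∩_; _∪_; ⁅_⁆; ∣_∣)
  renaming (⊤ to full; ⊥ to empty)
open import Function.Bundles using (_↔_; Inverse)
open import Relation.Binary.PropositionalEquality using (_≡_)

-- Rooted trees (children listed in some order; the order is irrelevant
-- for everything below).  The root of `node ts` is the top node.

data RTree : Set where
  node : List RTree → RTree

mutual
  size : RTree → ℕ
  size (node ts) = suc (sizes ts)

  sizes : List RTree → ℕ
  sizes []       = 0
  sizes (t ∷ ts) = size t + sizes ts

-- Vertices are labelled 0 … size t - 1 in preorder (root = 0).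
-- `edgesFrom k t` lists the (parent , child) edges of t when its root
-- gets label k.
mutual
  edgesFrom : ℕ → RTree → List (ℕ × ℕ)
  edgesFrom k (node ts) = childEdges k (suc k) ts

  childEdges : ℕ → ℕ → List RTree → List (ℕ × ℕ)
  childEdges r o []       = []
  childEdges r o (t ∷ ts) = (r , o) ∷ (edgesFrom o t ++ childEdges r (o + size t) ts)

Graph : ℕ → Set
Graph n = Fin n → Fin n → Bool

graph : (t : RTree) → Graph (size t)
graph t i j = any (λ e → ((proj₁ e ≡ᵇ toℕ i) ∧ (proj₂ e ≡ᵇ toℕ j))
                       ∨ ((proj₁ e ≡ᵇ toℕ j) ∧ (proj₂ e ≡ᵇ toℕ i)))
                  (edgesFrom 0 t)

-- Removing the link above a subtree s yields the two rooted trees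
-- t' = s (rooted at the endpoint of the edge lying in it) and
-- t'' = t with s deleted (rooted at the root of t).
-- `cuts t` lists, for every edge e of t exactly once, the pair (t' , t'').

mutual
  cutsL : List RTree → (List RTree → RTree) → List (RTree × RTree)
  cutsL []       ctx = []
  cutsL (s ∷ ss) ctx =
    (s , ctx ss) ∷ (cutsIn s (λ s' → ctx (s' ∷ ss)) ++ cutsL ss (λ ss' → ctx (s ∷ ss')))

  cutsIn : RTree → (RTree → RTree) → List (RTree × RTree)
  cutsIn (node us) ctx = cutsL us (λ us' → ctx (node us'))

cuts : RTree → List (RTree × RTree)
cuts (node ts) = cutsL ts node

module _ {n : ℕ} where

  _=ˢ_ : Subset n → Subset n → Bool
  A =ˢ B = all (λ i → eqB (lookup A i) (lookup B i)) (allFin n)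
    where
    eqB : Bool → Bool → Bool
    eqB true  b = b
    eqB false b = not b

  nonempty : Subset n → Bool
  nonempty S = any (lookup S) (allFin n)

  iter : {A : Set} → ℕ → (A → A) → A → A
  iter zero    f a = a
  iter (suc k) f a = f (iter k f a)

  expand : Graph n → Subset n → Subset n → Subset n
  expand G S R = tabulate (λ j → lookup R j
                    ∨ (lookup S j ∧ any (λ i → lookup R i ∧ G i j) (allFin n)))

  -- vertices reachable from u by a path inside S (paths have < n edges)
  reach : Graph n → Subset n → Fin n → Subset n
  reach G S u = iter n (expand G S) ⁅ u ⁆

  connected : Graph n → Subset n → Bool
  connected G S = all (λ u → not (lookup S u) ∨ (reach G S u =ˢ S)) (allFin n)

  isTube : Graph n → Subset n → Bool
  isTube G S = nonempty S ∧ connected G S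

  partitioned : List (Subset n) → Subset n → Bool
  partitioned τ T = any (λ A → any (λ B → ((A ∩ B) =ˢ empty) ∧ ((A ∪ B) =ˢ T)) τ) τ

  _⊆ᵇ_ : Subset n → Subset n → Bool
  A ⊆ᵇ B = (A ∩ B) =ˢ A

  compatible : Subset n → Subset n → Bool
  compatible A B = (A ⊆ᵇ B) ∨ (B ⊆ᵇ A) ∨ ((A ∩ B) =ˢ empty)

  isBinaryTubing : Graph n → List (Subset n) → Bool
  isBinaryTubing G τ =
    all (isTube G) τ
    ∧ all (λ A → all (compatible A) τ) τ
    ∧ any (λ T → T =ˢ full) τ
    ∧ all (λ T → (∣ T ∣ ≡ᵇ 1) ∨ partitioned τ T) τ

allSubsets : (n : ℕ) → List (Subset n)
allSubsets zero    = [ [] ]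
allSubsets (suc n) = map (true ∷_) (allSubsets n) ++ map (false ∷_) (allSubsets n)

-- all sub-lists (= all subsets, when the input has no repetitions)
sublists : {A : Set} → List A → List (List A)
sublists []       = [ [] ]
sublists (x ∷ xs) = map (x ∷_) (sublists xs) ++ sublists xs

countB : {A : Set} → (A → Bool) → List A → ℕ
countB p []       = 0
countB p (x ∷ xs) with p x
... | true  = suc (countB p xs)
... | false = countB p xs

NG : (n : ℕ) → Graph n → ℕ
NG n G = countB (isBinaryTubing G) (sublists (allSubsets n))

N : RTree → ℕ
N t = NG (size t) (graph t)

UnderlyingIso : RTree → RTree → Set
UnderlyingIso t₁ t₂ =
  Data.Product.Σ (Fin (size t₁) ↔ Fin (size t₂)) λ f →
    ∀ i j → graph t₁ i j ≡ graph t₂ (Inverse.to f i) (Inverse.to f j)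

-- A binary tubing of a connected graph on at least two vertices contains the whole vertex set,
-- which it splits into two tubes A and B; by pairwise compatibility this bipartition is the
-- only one in the tubing.  Conversely, binary tubings containing A and B correspond exactly to
-- pairs of binary tubings of the subgraphs induced on A and on B (restrict, respectively take
-- the union and add the whole vertex set).  So N is the sum, over the bipartitions of the
-- vertex set into two tubes, of the products of the numbers for the two parts.  In a rooted
-- tree every edge yields such a bipartition, and every bipartition comes from exactly one
-- edge: the part B avoiding the root is the subtree hanging below the least-labelled vertex
-- of B.  Invariance holds because transporting tubings along a graph isomorphism is a
-- bijection.
module Submission where

open import Defs

import Algebra.Properties.CommutativeSemigroup
open import Data.Bool using (Bool; true; false; _∧_; _∨_; not; T)
import Data.Bool as Bool
open import Data.Bool.ListAction using (all; any; and)
open import Data.Bool.Properties using (T?; T-≡; T-not-≡; T-∧; T-∨; ⇔→≡)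
open import Data.Empty using (⊥; ⊥-elim)
open import Data.Fin using (Fin; toℕ; fromℕ<) renaming (zero to fzero; suc to fsuc)
import Data.Fin as Fin
open import Data.Fin.Properties using (any?; ¬∀⟶∃¬-smallest; toℕ-injective; toℕ-fromℕ<; toℕ-inject; toℕ<n)
open import Data.Fin.Subset using (Subset; _∩_; _∪_; ⁅_⁆; ∣_∣; Nonempty; _⊆_; _⊂_)
  renaming (⊤ to full; ⊥ to empty; _∈_ to _∈ₛ_; _∉_ to _∉ₛ_)
open import Data.Fin.Subset.Properties
  using (_∈?_; ⊆-antisym; ⊆⊤; Empty-unique; p⊆q⇒∣p∣≤∣q∣; ∈⊤; ∉⊥; x∈⁅x⁆; x∈⁅y⁆⇒x≡y; ∣⁅x⁆∣≡1;
         p⊂q⇒∣p∣<∣q∣; ∣p∣≤n; x∈p∩q⁺; x∈p∩q⁻; x∈p∪q⁺; x∈p∪q⁻; p⊆p∪q; q⊆p∪q; ∪-comm)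
open import Data.List using (List; []; _∷_; _++_; map; length; allFin; filterᵇ; concatMap; cartesianProductWith)
import Data.List as List
open import Data.List.Membership.Propositional using (_∈_; find; lose)
open import Data.List.Membership.Propositional.Properties
  using (∈-allFin; ∈-map⁺; ∈-map⁻; ∈-++⁺ˡ; ∈-++⁺ʳ; ∈-++⁻; ∈-∃++; ∈-filter⁺; ∈-filter⁻; ∈-concatMap⁺; ∈-concatMap⁻)
open import Data.List.Properties using (map-tabulate)
import Data.List.Properties as List
open import Data.List.Relation.Binary.Permutation.Propositional
  using (_↭_; ↭-sym; ↭-trans; ↭-reflexive; ↭-prep; module PermutationReasoning)
import Data.List.Relation.Binary.Permutation.Propositional.Properties as ↭
open import Data.List.Relation.Unary.All using ([]; _∷_)
import Data.List.Relation.Unary.All as All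
import Data.List.Relation.Unary.All.Properties as All
open import Data.List.Relation.Unary.AllPairs using (AllPairs; []; _∷_)
import Data.List.Relation.Unary.AllPairs as AllPairs
import Data.List.Relation.Unary.AllPairs.Properties as AllPairs
open import Data.List.Relation.Unary.Any using (Any; here; there; satisfied)
import Data.List.Relation.Unary.Any as Any
import Data.List.Relation.Unary.Any.Properties as Any
open import Data.List.Relation.Unary.Unique.Propositional using (Unique)
import Data.List.Relation.Unary.Unique.Propositional.Properties as Unique
open import Data.Nat using (ℕ; zero; suc; _+_; _*_; _∸_; _≤_; _<_; _≡ᵇ_; z≤n; s≤s; _<?_; _≤?_)
import Data.Nat as Nat
open import Data.Nat.ListAction using (sum)
open import Data.Nat.Properties
  using (≡ᵇ⇒≡; ≡⇒≡ᵇ; ≤-refl; ≤-reflexive; ≤-trans; ≤-antisym; <-trans; <-≤-trans; ≤-<-trans; <-irrefl;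
         <-≤-connex; <⇒≱; ≮⇒≥; ≤∧≢⇒<; n≤1+n; n<1+n; n≢0⇒n>0; +-comm; +-assoc; +-suc; +-identityʳ;
         m≤m+n; m≤n+m; m<m+n; +-monoˡ-≤; +-monoˡ-<; +-monoʳ-<; +-cancelʳ-≤; +-cancelʳ-≡;
         m∸n+n≡m; m+n∸n≡m; m+n∸m≡n; m+[n∸m]≡n; ∸-monoˡ-≤; ∸-monoˡ-<; +-commutativeSemigroup; module ≤-Reasoning)
open import Data.Product using (Σ; _×_; _,_; proj₁; proj₂; ∃; ∃₂)
import Data.Product as Product
open import Data.Product.Function.NonDependent.Propositional using (_×-⇔_)
open import Data.Sum using (_⊎_; inj₁; inj₂; [_,_]′)
import Data.Sum as Sum
open import Data.Sum.Function.Propositional using (_⊎-⇔_)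
open import Data.Vec using ([]; _∷_; lookup; tabulate)
import Data.Vec.Properties as Vec
open import Data.Vec.Properties using (≡-dec; lookup∘tabulate; lookup⇒[]=; []=⇒lookup; tabulate∘lookup; tabulate-cong)
open import Function.Base using (id; _∘_)
open import Function.Bundles using (_⇔_; mk⇔; Equivalence; _↔_; Inverse)
open import Function.Properties.Equivalence using () renaming (trans to ⇔-trans; sym to ⇔-sym)
open import Function.Properties.Inverse using (↔-sym)
open import Relation.Binary.PropositionalEquality
  using (_≡_; _≢_; refl; sym; trans; cong; cong₂; subst; subst₂; module ≡-Reasoning)
open import Relation.Nullary using (¬_; Dec; yes; no; ¬?; _×-dec_)
open import Relation.Nullary.Decidable using (⌊_⌋; toWitness; fromWitness; decidable-stable)

open Equivalence using (to; from)
open Algebra.Properties.CommutativeSemigroup +-commutativeSemigroup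
  using () renaming (xy∙z≈xz∙y to +-right-comm; x∙yz≈y∙xz to +-left-comm)

-- The pointwise test inside _=ˢ_ is local to Defs, so reflexivity is proved by unfolding
-- allFin (suc n) instead of pointwise.
all-tabulate-fsuc : ∀ {n} (p : Fin (suc n) → Bool) (q : Fin n → Bool) → (∀ i → p (fsuc i) ≡ q i) →
                    all p (List.tabulate fsuc) ≡ all q (allFin n)
all-tabulate-fsuc p q p∘fsuc≗q =
  cong and (trans (map-tabulate fsuc p) (trans (List.tabulate-cong p∘fsuc≗q) (sym (map-tabulate id q))))

=ˢ-refl : ∀ {n} (A : Subset n) → T (A =ˢ A)
=ˢ-refl []          = _
=ˢ-refl {suc n} (true ∷ A)  = subst T (sym (all-tabulate-fsuc {n} _ _ λ _ → refl)) (=ˢ-refl A)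
=ˢ-refl {suc n} (false ∷ A) = subst T (sym (all-tabulate-fsuc {n} _ _ λ _ → refl)) (=ˢ-refl A)

module _ {n : ℕ} where

  ∈ₛ⇒T : ∀ {S : Subset n} {i} → i ∈ₛ S → T (lookup S i)
  ∈ₛ⇒T h = from T-≡ ([]=⇒lookup h)

  T⇒∈ₛ : ∀ {S : Subset n} {i} → T (lookup S i) → i ∈ₛ S
  T⇒∈ₛ {S} {i} h = lookup⇒[]= i S (to T-≡ h)

  ∈ₛ-tabulate⁺ : ∀ {f : Fin n → Bool} {i} → T (f i) → i ∈ₛ tabulate f
  ∈ₛ-tabulate⁺ {f} {i} h = T⇒∈ₛ (subst T (sym (lookup∘tabulate f i)) h)

  ∈ₛ-tabulate⁻ : ∀ {f : Fin n → Bool} {i} → i ∈ₛ tabulate f → T (f i)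
  ∈ₛ-tabulate⁻ {f} {i} h = subst T (lookup∘tabulate f i) (∈ₛ⇒T h)

  =ˢ⇒≡ : ∀ {A B : Subset n} → T (A =ˢ B) → A ≡ B
  =ˢ⇒≡ {A} {B} h =
    trans (sym (tabulate∘lookup A)) (trans (tabulate-cong agree) (tabulate∘lookup B))
    where
    agree : ∀ i → lookup A i ≡ lookup B i
    agree i with lookup A i | lookup B i | All.lookup (All.all⁺ _ (allFin n) h) (∈-allFin i)
    ... | true  | true  | _ = refl
    ... | false | false | _ = refl

  =ˢ⇔≡ : ∀ {A B : Subset n} → T (A =ˢ B) ⇔ A ≡ B
  =ˢ⇔≡ {A} = mk⇔ =ˢ⇒≡ λ { refl → =ˢ-refl A }

  nonempty⇔ : ∀ {S : Subset n} → T (nonempty S) ⇔ Nonempty S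
  nonempty⇔ {S} = mk⇔
    (λ h → let i , i∈S = satisfied (Any.any⁻ _ (allFin n) h) in i , T⇒∈ₛ i∈S)
    (λ (i , i∈S) → Any.any⁺ _ (Any.map (λ { refl → ∈ₛ⇒T i∈S }) (∈-allFin i)))

  ⊆∧≢⇒⊂ : ∀ {A B : Subset n} → A ⊆ B → A ≢ B → A ⊂ B
  ⊆∧≢⇒⊂ {A} {B} A⊆B A≢B with any? (λ x → x ∈? B ×-dec ¬? (x ∈? A))
  ... | yes (x , x∈B , x∉A) = A⊆B , x , x∈B , x∉A
  ... | no ∄x = ⊥-elim (A≢B (⊆-antisym A⊆B B⊆A))
    where
    B⊆A : B ⊆ A
    B⊆A {x} x∈B = decidable-stable (x ∈? A) λ x∉A → ∄x (x , x∈B , x∉A)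

  ClosedIn : Graph n → Subset n → Subset n → Set
  ClosedIn G X U = ∀ {i j} → i ∈ₛ X → j ∈ₛ X → T (G i j) → i ∈ₛ U → j ∈ₛ U

  Connected : Graph n → Subset n → Set
  Connected G X = ∀ {u v} → u ∈ₛ X → v ∈ₛ X → ∀ {U} → ClosedIn G X U → u ∈ₛ U → v ∈ₛ U

  module Reachability (G : Graph n) (X : Subset n) where

    expand-⊇ : ∀ {R} → R ⊆ expand G X R
    expand-⊇ j∈R = ∈ₛ-tabulate⁺ (from T-∨ (inj₁ (∈ₛ⇒T j∈R)))

    expand-step : ∀ {R i j} → j ∈ₛ X → i ∈ₛ R → T (G i j) → j ∈ₛ expand G X R
    expand-step {R} {i} j∈X i∈R Gij = ∈ₛ-tabulate⁺ (from T-∨ (inj₂ (from T-∧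
      (∈ₛ⇒T j∈X , Any.any⁺ _ (Any.map (λ { refl → from T-∧ (∈ₛ⇒T i∈R , Gij) }) (∈-allFin i))))))

    expand-cases : ∀ {R j} → j ∈ₛ expand G X R → j ∈ₛ R ⊎ (j ∈ₛ X × ∃ λ i → i ∈ₛ R × T (G i j))
    expand-cases {R} {j} h with to (T-∨ {lookup R j}) (∈ₛ-tabulate⁻ h)
    ... | inj₁ j∈R = inj₁ (T⇒∈ₛ j∈R)
    ... | inj₂ h′ with to (T-∧ {lookup X j}) h′
    ... | j∈X , ∃i with satisfied (Any.any⁻ _ (allFin n) ∃i)
    ... | i , RiGij with to (T-∧ {lookup R i}) RiGij
    ... | i∈R , Gij = inj₂ (T⇒∈ₛ j∈X , i , T⇒∈ₛ i∈R , Gij)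

    reachIn : Fin n → ℕ → Subset n
    reachIn u k = iter {n} k (expand G X) ⁅ u ⁆

    source∈reachIn : ∀ u k → u ∈ₛ reachIn u k
    source∈reachIn u zero    = x∈⁅x⁆ u
    source∈reachIn u (suc k) = expand-⊇ (source∈reachIn u k)

    reachIn⊆X : ∀ {u} → u ∈ₛ X → ∀ k → reachIn u k ⊆ X
    reachIn⊆X u∈X zero    j∈R = subst (_∈ₛ X) (sym (x∈⁅y⁆⇒x≡y _ j∈R)) u∈X
    reachIn⊆X u∈X (suc k) j∈R with expand-cases j∈R
    ... | inj₁ j∈R′      = reachIn⊆X u∈X k j∈R′
    ... | inj₂ (j∈X , _) = j∈X

    reachIn⊆closed : ∀ {u U} → u ∈ₛ X → ClosedIn G X U → u ∈ₛ U → ∀ k → reachIn u k ⊆ U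
    reachIn⊆closed u∈X closed u∈U zero    j∈R = subst (_∈ₛ _) (sym (x∈⁅y⁆⇒x≡y _ j∈R)) u∈U
    reachIn⊆closed u∈X closed u∈U (suc k) j∈R with expand-cases j∈R
    ... | inj₁ j∈R′ = reachIn⊆closed u∈X closed u∈U k j∈R′
    ... | inj₂ (j∈X , i , i∈R , Gij) =
      closed (reachIn⊆X u∈X k i∈R) j∈X Gij (reachIn⊆closed u∈X closed u∈U k i∈R)

    -- Until it stabilises, the k-th search layer has more than k vertices.
    stable-or-large : ∀ u k → expand G X (reachIn u k) ≡ reachIn u k ⊎ k < ∣ reachIn u k ∣
    stable-or-large u zero = inj₂ (subst (0 <_) (sym (∣⁅x⁆∣≡1 u)) (s≤s z≤n))
    stable-or-large u (suc k) with ≡-dec Bool._≟_ (expand G X (reachIn u k)) (reachIn u k)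
    ... | yes stable = inj₁ (cong (expand G X) stable)
    ... | no unstable with stable-or-large u k
    ... | inj₁ stable = ⊥-elim (unstable stable)
    ... | inj₂ large  = inj₂ (<-≤-trans (s≤s large)
                          (p⊂q⇒∣p∣<∣q∣ (⊆∧≢⇒⊂ expand-⊇ (unstable ∘ sym))))

    reach-closed : ∀ u → ClosedIn G X (reach G X u)
    reach-closed u {j = j} i∈X j∈X Gij i∈R = subst (j ∈ₛ_) fixed (expand-step j∈X i∈R Gij)
      where
      fixed : expand G X (reachIn u n) ≡ reachIn u n
      fixed with stable-or-large u n
      ... | inj₁ stable = stable
      ... | inj₂ large  = ⊥-elim (<-irrefl refl (<-≤-trans large (∣p∣≤n (reachIn u n))))

  connected⇔ : ∀ {G X} → T (connected G X) ⇔ Connected G X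
  connected⇔ {G} {X} = mk⇔ to′ from′
    where
    open Reachability G X
    to′ : T (connected G X) → Connected G X
    to′ h {u} u∈X v∈X closed u∈U
      with to (T-∨ {not (lookup X u)}) (All.lookup (All.all⁺ _ (allFin n) h) (∈-allFin u))
    ... | inj₁ u∉X = ⊥-elim (subst T (to T-not-≡ u∉X) (∈ₛ⇒T u∈X))
    ... | inj₂ reach≡X = reachIn⊆closed u∈X closed u∈U n (subst (_ ∈ₛ_) (sym (=ˢ⇒≡ reach≡X)) v∈X)
    from′ : Connected G X → T (connected G X)
    from′ conn = All.all⁻ _ (All.tabulate⁺ reach-is-X)
      where
      reach-is-X : ∀ u → T (not (lookup X u) ∨ (reach G X u =ˢ X))
      reach-is-X u with lookup X u in u∈X
      ... | false = _
      ... | true  = from =ˢ⇔≡ (⊆-antisym (reachIn⊆X (lookup⇒[]= u X u∈X) n)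
              λ v∈X → conn (lookup⇒[]= u X u∈X) v∈X (reach-closed u) (source∈reachIn u n))

  connected-crossing : ∀ {G X I a b} → Connected G X →
    (∀ {i j} → T (G i j) → i ∈ₛ I → j ∉ₛ I → i ≡ a × j ≡ b) →
    ∀ {x y} → x ∈ₛ X → y ∈ₛ X → x ∈ₛ I → y ∉ₛ I → a ∈ₛ X × b ∈ₛ X
  connected-crossing {G} {X} {I} {a} {b} conn only-exit {x} {y} x∈X y∈X x∈I y∉I =
    decidable-stable (a ∈? X) (λ a∉X → some-exit λ i∈X _ Gij i∈I j∉I →
      a∉X (subst (_∈ₛ X) (proj₁ (only-exit Gij i∈I j∉I)) i∈X)) ,
    decidable-stable (b ∈? X) (λ b∉X → some-exit λ _ j∈X Gij i∈I j∉I →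
      b∉X (subst (_∈ₛ X) (proj₂ (only-exit Gij i∈I j∉I)) j∈X))
    where
    some-exit : ¬ (∀ {i j} → i ∈ₛ X → j ∈ₛ X → T (G i j) → i ∈ₛ I → j ∉ₛ I → ⊥)
    some-exit no-exit = y∉I (conn x∈X y∈X closed x∈I)
      where
      closed : ClosedIn G X I
      closed {i} {j} i∈X j∈X Gij i∈I = decidable-stable (j ∈? I) (no-exit i∈X j∈X Gij i∈I)

  connected-by-descent : ∀ {G} {r : Fin n} → toℕ r ≡ 0 → (∀ i j → G i j ≡ G j i) →
    (∀ v → 0 < toℕ v → ∃ λ p → toℕ p < toℕ v × T (G p v)) → Connected G full
  connected-by-descent {G} {r} r≡0 symmetric descent {u} {v} _ _ {U} closed u∈U = down n v (toℕ<n v)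
    where
    root-unique : ∀ w → toℕ w ≡ 0 → w ≡ r
    root-unique w w≡0 = toℕ-injective (trans w≡0 (sym r≡0))
    up : ∀ fuel w → toℕ w < fuel → w ∈ₛ U → r ∈ₛ U
    up (suc fuel) w w<fuel w∈U with toℕ w Nat.≟ 0
    ... | yes w≡0 = subst (_∈ₛ U) (root-unique w w≡0) w∈U
    ... | no  w≢0 with descent w (n≢0⇒n>0 w≢0)
    ... | p , p<w , Gpw = up fuel p (≤-trans p<w (Nat.s≤s⁻¹ w<fuel)) (closed ∈⊤ ∈⊤ (subst T (symmetric p w) Gpw) w∈U)
    down : ∀ fuel w → toℕ w < fuel → w ∈ₛ U
    down (suc fuel) w w<fuel with toℕ w Nat.≟ 0
    ... | yes w≡0 = subst (_∈ₛ U) (sym (root-unique w w≡0)) (up n u (toℕ<n u) u∈U)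
    ... | no  w≢0 with descent w (n≢0⇒n>0 w≢0)
    ... | p , p<w , Gpw = closed ∈⊤ ∈⊤ Gpw (down fuel p (≤-trans p<w (Nat.s≤s⁻¹ w<fuel)))

  Disjoint : Subset n → Subset n → Set
  Disjoint A B = ∀ {i} → i ∈ₛ A → i ∈ₛ B → ⊥

  Compatible : Subset n → Subset n → Set
  Compatible A B = A ⊆ B ⊎ B ⊆ A ⊎ Disjoint A B

  Singleton : Subset n → Set
  Singleton X = ∃ λ x → X ≡ ⁅ x ⁆

  Tube : Graph n → Subset n → Set
  Tube G X = Nonempty X × Connected G X

  Partitioned : List (Subset n) → Subset n → Set
  Partitioned τ X = ∃₂ λ A B → A ∈ τ × B ∈ τ × Disjoint A B × A ∪ B ≡ X

  record BinaryTubing (G : Graph n) (τ : List (Subset n)) : Set where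
    field
      tube     : ∀ {X} → X ∈ τ → Tube G X
      nested   : ∀ {X Y} → X ∈ τ → Y ∈ τ → Compatible X Y
      full∈    : full ∈ τ
      binary   : ∀ {X} → X ∈ τ → Singleton X ⊎ Partitioned τ X

  ∩≡empty⇔Disjoint : ∀ {A B : Subset n} → A ∩ B ≡ empty ⇔ Disjoint A B
  ∩≡empty⇔Disjoint {A} {B} = mk⇔
    (λ A∩B≡∅ {i} i∈A i∈B → ∉⊥ (subst (i ∈ₛ_) A∩B≡∅ (x∈p∩q⁺ (i∈A , i∈B))))
    (λ disj → ⊆-antisym (λ i∈A∩B → let i∈A , i∈B = x∈p∩q⁻ A B i∈A∩B in ⊥-elim (disj i∈A i∈B))
                        (λ i∈∅ → ⊥-elim (∉⊥ i∈∅)))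

  ∩≡⇔⊆ : ∀ {A B : Subset n} → A ∩ B ≡ A ⇔ A ⊆ B
  ∩≡⇔⊆ {A} {B} = mk⇔
    (λ A∩B≡A {i} i∈A → proj₂ (x∈p∩q⁻ A B (subst (i ∈ₛ_) (sym A∩B≡A) i∈A)))
    (λ A⊆B → ⊆-antisym (λ i∈A∩B → proj₁ (x∈p∩q⁻ A B i∈A∩B)) (λ i∈A → x∈p∩q⁺ (i∈A , A⊆B i∈A)))

  ∣∣≡1⇒Singleton : ∀ {m} (X : Subset m) → ∣ X ∣ ≡ 1 → ∃ λ x → X ≡ ⁅ x ⁆
  ∣∣≡1⇒Singleton (true ∷ X) ∣X∣≡1 = fzero , cong (true ∷_) (Empty-unique λ (i , i∈X) → 1≰0 (∣⁅i⁆∣≤∣X∣ i∈X))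
    where
    ∣⁅i⁆∣≤∣X∣ : ∀ {i} → i ∈ₛ X → 1 ≤ 0
    ∣⁅i⁆∣≤∣X∣ {i} i∈X = subst₂ _≤_ (∣⁅x⁆∣≡1 i) (cong Nat.pred ∣X∣≡1)
      (p⊆q⇒∣p∣≤∣q∣ λ j∈⁅i⁆ → subst (_∈ₛ X) (sym (x∈⁅y⁆⇒x≡y i j∈⁅i⁆)) i∈X)
    1≰0 : 1 ≤ 0 → ⊥
    1≰0 ()
  ∣∣≡1⇒Singleton (false ∷ X) ∣X∣≡1 =
    let x , X≡⁅x⁆ = ∣∣≡1⇒Singleton X ∣X∣≡1 in fsuc x , cong (false ∷_) X≡⁅x⁆

  singleton⇔ : ∀ {X : Subset n} → T (∣ X ∣ ≡ᵇ 1) ⇔ Singleton X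
  singleton⇔ {X} = mk⇔ (λ h → ∣∣≡1⇒Singleton X (≡ᵇ⇒≡ _ 1 h))
                       (λ { (x , refl) → ≡⇒≡ᵇ _ 1 (∣⁅x⁆∣≡1 x) })

  ⊆ᵇ⇔⊆ : ∀ {A B : Subset n} → T (A ⊆ᵇ B) ⇔ A ⊆ B
  ⊆ᵇ⇔⊆ = ⇔-trans =ˢ⇔≡ ∩≡⇔⊆

  disjointᵇ⇔Disjoint : ∀ {A B : Subset n} → T ((A ∩ B) =ˢ empty) ⇔ Disjoint A B
  disjointᵇ⇔Disjoint = ⇔-trans =ˢ⇔≡ ∩≡empty⇔Disjoint

  compatible⇔ : ∀ {A B : Subset n} → T (compatible A B) ⇔ Compatible A B
  compatible⇔ = ⇔-trans T-∨ (⊆ᵇ⇔⊆ ⊎-⇔ ⇔-trans T-∨ (⊆ᵇ⇔⊆ ⊎-⇔ disjointᵇ⇔Disjoint))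

  tube⇔ : ∀ {G} {X : Subset n} → T (isTube G X) ⇔ Tube G X
  tube⇔ = ⇔-trans T-∧ (nonempty⇔ ×-⇔ connected⇔)

  partitioned⇔ : ∀ {τ} {X : Subset n} → T (partitioned τ X) ⇔ Partitioned τ X
  partitioned⇔ {τ} = mk⇔ to′ from′
    where
    to′ : ∀ {X} → T (partitioned τ X) → Partitioned τ X
    to′ h with find (Any.any⁻ _ τ h)
    ... | A , A∈τ , h′ with find (Any.any⁻ _ τ h′)
    ... | B , B∈τ , h″ with to T-∧ h″
    ... | disj , A∪B≡X = A , B , A∈τ , B∈τ , to disjointᵇ⇔Disjoint disj , =ˢ⇒≡ A∪B≡X
    from′ : ∀ {X} → Partitioned τ X → T (partitioned τ X)
    from′ (A , B , A∈τ , B∈τ , disj , refl) = Any.any⁺ _ (lose A∈τ (Any.any⁺ _ (lose B∈τ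
      (from T-∧ (from disjointᵇ⇔Disjoint disj , =ˢ-refl (A ∪ B))))))

  binaryTubing⇔ : ∀ {G τ} → T (isBinaryTubing G τ) ⇔ BinaryTubing G τ
  binaryTubing⇔ {G} {τ} = mk⇔ to′ from′
    where
    to′ : T (isBinaryTubing G τ) → BinaryTubing G τ
    to′ h with to T-∧ h
    ... | tubes , h′ with to T-∧ h′
    ... | nested , h″ with to T-∧ h″
    ... | has-full , binary = record
      { tube   = λ X∈τ → to tube⇔ (All.lookup (All.all⁺ _ τ tubes) X∈τ)
      ; nested = λ X∈τ Y∈τ → to compatible⇔ (All.lookup (All.all⁺ _ τ (All.lookup (All.all⁺ _ τ nested) X∈τ)) Y∈τ)
      ; full∈  = let F , F∈τ , F≡full = find (Any.any⁻ _ τ has-full) in subst (_∈ τ) (=ˢ⇒≡ F≡full) F∈τ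
      ; binary = λ X∈τ → to (singleton⇔ ⊎-⇔ partitioned⇔) (to T-∨ (All.lookup (All.all⁺ _ τ binary) X∈τ))
      }
    from′ : BinaryTubing G τ → T (isBinaryTubing G τ)
    from′ bt = from T-∧ (All.all⁻ _ (All.tabulate (from tube⇔ ∘ tube)) ,
               from T-∧ (All.all⁻ _ (All.tabulate λ X∈τ → All.all⁻ _ (All.tabulate (from compatible⇔ ∘ nested X∈τ))) ,
               from T-∧ (Any.any⁺ _ (lose full∈ (=ˢ-refl (full {n}))) ,
                         All.all⁻ _ (All.tabulate (from T-∨ ∘ from (singleton⇔ ⊎-⇔ partitioned⇔) ∘ binary)))))
      where open BinaryTubing bt

  Partitioned-mono : ∀ {τ τ′ X} → (∀ {Y} → Y ∈ τ → Y ∈ τ′) → Partitioned τ X → Partitioned τ′ X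
  Partitioned-mono τ⊆τ′ (A , B , A∈τ , B∈τ , disj , A∪B≡X) = A , B , τ⊆τ′ A∈τ , τ⊆τ′ B∈τ , disj , A∪B≡X

  BinaryTubing-resp : ∀ {G τ τ′} → (∀ {X} → X ∈ τ → X ∈ τ′) → (∀ {X} → X ∈ τ′ → X ∈ τ) →
                      BinaryTubing G τ → BinaryTubing G τ′
  BinaryTubing-resp τ⊆τ′ τ′⊆τ bt = record
    { tube   = tube ∘ τ′⊆τ
    ; nested = λ X∈ Y∈ → nested (τ′⊆τ X∈) (τ′⊆τ Y∈)
    ; full∈  = τ⊆τ′ full∈
    ; binary = Sum.map₂ (Partitioned-mono τ⊆τ′) ∘ binary ∘ τ′⊆τ
    }
    where open BinaryTubing bt

module _ {A : Set} where

  countB≡length-filterᵇ : ∀ (p : A → Bool) xs → countB p xs ≡ length (filterᵇ p xs)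
  countB≡length-filterᵇ p [] = refl
  countB≡length-filterᵇ p (x ∷ xs) with p x
  ... | true  = cong suc (countB≡length-filterᵇ p xs)
  ... | false = countB≡length-filterᵇ p xs

  filterᵇ∈sublists : ∀ (p : A → Bool) xs → filterᵇ p xs ∈ sublists xs
  filterᵇ∈sublists p [] = here refl
  filterᵇ∈sublists p (x ∷ xs) with p x
  ... | true  = ∈-++⁺ˡ (∈-map⁺ (x ∷_) (filterᵇ∈sublists p xs))
  ... | false = ∈-++⁺ʳ (map (x ∷_) (sublists xs)) (filterᵇ∈sublists p xs)

  ∈-sublists⁻ : ∀ {xs σ : List A} {y} → σ ∈ sublists xs → y ∈ σ → y ∈ xs
  ∈-sublists⁻ {[]} (here refl) ()
  ∈-sublists⁻ {x ∷ xs} σ∈ y∈σ with ∈-++⁻ (map (x ∷_) (sublists xs)) σ∈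
  ... | inj₂ σ∈′ = there (∈-sublists⁻ σ∈′ y∈σ)
  ... | inj₁ x∷σ∈ with ∈-map⁻ (x ∷_) x∷σ∈
  ... | σ′ , σ′∈ , refl with y∈σ
  ...   | here refl = here refl
  ...   | there y∈σ′ = there (∈-sublists⁻ σ′∈ y∈σ′)

  Unique-sublists : ∀ {xs : List A} → Unique xs → Unique (sublists xs)
  Unique-sublists [] = [] ∷ []
  Unique-sublists {x ∷ xs} (x∉xs ∷ xs!) =
    Unique.++⁺ (Unique.map⁺ (List.∷-injectiveʳ {x = x}) (Unique-sublists xs!)) (Unique-sublists xs!) apart
    where
    apart : ∀ {σ} → ¬ (σ ∈ map (x ∷_) (sublists xs) × σ ∈ sublists xs)
    apart (x∷σ∈ , σ∈) with ∈-map⁻ (x ∷_) x∷σ∈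
    ... | _ , _ , refl = All.lookup x∉xs (∈-sublists⁻ σ∈ (here refl)) refl

  sublists-≡ : ∀ {xs σ σ′} → Unique xs → σ ∈ sublists xs → σ′ ∈ sublists xs →
               (∀ {y} → y ∈ σ → y ∈ σ′) → (∀ {y} → y ∈ σ′ → y ∈ σ) → σ ≡ σ′
  sublists-≡ {[]} [] (here refl) (here refl) _ _ = refl
  sublists-≡ {x ∷ xs} (x∉xs ∷ xs!) σ∈ σ′∈ σ⊆σ′ σ′⊆σ
    with ∈-++⁻ (map (x ∷_) (sublists xs)) σ∈ | ∈-++⁻ (map (x ∷_) (sublists xs)) σ′∈
  ... | inj₂ σ∈′ | inj₂ σ′∈′ = sublists-≡ xs! σ∈′ σ′∈′ σ⊆σ′ σ′⊆σ
  ... | inj₁ x∷σ∈ | inj₂ σ′∈′ with ∈-map⁻ (x ∷_) x∷σ∈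
  ...   | _ , _ , refl = ⊥-elim (All.lookup x∉xs (∈-sublists⁻ σ′∈′ (σ⊆σ′ (here refl))) refl)
  sublists-≡ {x ∷ xs} (x∉xs ∷ xs!) σ∈ σ′∈ σ⊆σ′ σ′⊆σ | inj₂ σ∈′ | inj₁ x∷σ′∈ with ∈-map⁻ (x ∷_) x∷σ′∈
  ...   | _ , _ , refl = ⊥-elim (All.lookup x∉xs (∈-sublists⁻ σ∈′ (σ′⊆σ (here refl))) refl)
  sublists-≡ {x ∷ xs} (x∉xs ∷ xs!) σ∈ σ′∈ σ⊆σ′ σ′⊆σ | inj₁ x∷σ∈ | inj₁ x∷σ′∈
    with ∈-map⁻ (x ∷_) x∷σ∈ | ∈-map⁻ (x ∷_) x∷σ′∈
  ... | σ , σ∈′ , refl | σ′ , σ′∈′ , refl =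
    cong (x ∷_) (sublists-≡ xs! σ∈′ σ′∈′ (drop-x σ∈′ σ⊆σ′) (drop-x σ′∈′ σ′⊆σ))
    where
    drop-x : ∀ {ρ ρ′} → ρ ∈ sublists xs → (∀ {y} → y ∈ x ∷ ρ → y ∈ x ∷ ρ′) → ∀ {y} → y ∈ ρ → y ∈ ρ′
    drop-x ρ∈ ρ⊆ρ′ y∈ρ with ρ⊆ρ′ (there y∈ρ)
    ... | here refl = ⊥-elim (All.lookup x∉xs (∈-sublists⁻ ρ∈ y∈ρ) refl)
    ... | there y∈ρ′ = y∈ρ′

  length-≤ : ∀ {xs ys : List A} → Unique xs → (∀ {x} → x ∈ xs → x ∈ ys) → length xs ≤ length ys
  length-≤ {[]} _ _ = z≤n
  length-≤ {x ∷ xs} {ys} (x∉xs ∷ xs!) xs⊆ys with ∈-∃++ (xs⊆ys (here refl))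
  ... | ys₁ , ys₂ , refl = begin
    suc (length xs)              ≤⟨ s≤s (length-≤ xs! xs⊆ys₁++ys₂) ⟩
    suc (length (ys₁ ++ ys₂))    ≡⟨ cong suc (List.length-++ ys₁) ⟩
    suc (length ys₁ + length ys₂) ≡⟨ sym (+-suc (length ys₁) (length ys₂)) ⟩
    length ys₁ + length (x ∷ ys₂) ≡⟨ sym (List.length-++ ys₁) ⟩
    length (ys₁ ++ x ∷ ys₂)      ∎
    where
    open ≤-Reasoning
    skip-x : ∀ {y} zs → y ∈ zs ++ x ∷ ys₂ → y ≢ x → y ∈ zs ++ ys₂
    skip-x []       (here refl)  y≢x = ⊥-elim (y≢x refl)
    skip-x []       (there y∈)   _   = y∈
    skip-x (_ ∷ zs) (here refl)  _   = here refl
    skip-x (_ ∷ zs) (there y∈)   y≢x = there (skip-x zs y∈ y≢x)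
    xs⊆ys₁++ys₂ : ∀ {y} → y ∈ xs → y ∈ ys₁ ++ ys₂
    xs⊆ys₁++ys₂ y∈xs = skip-x ys₁ (xs⊆ys (there y∈xs)) (λ y≡x → All.lookup x∉xs y∈xs (sym y≡x))

  length-≡ : ∀ {xs ys : List A} → Unique xs → Unique ys →
             (∀ {x} → x ∈ xs → x ∈ ys) → (∀ {x} → x ∈ ys → x ∈ xs) → length xs ≡ length ys
  length-≡ xs! ys! xs⊆ys ys⊆xs = ≤-antisym (length-≤ xs! xs⊆ys) (length-≤ ys! ys⊆xs)

  Unique-map-on⁺ : ∀ {B : Set} {f : A → B} {xs} → Unique xs →
                   (∀ {x y} → x ∈ xs → y ∈ xs → f x ≡ f y → x ≡ y) → Unique (map f xs)
  Unique-map-on⁺ [] _ = []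
  Unique-map-on⁺ (x∉xs ∷ xs!) f-inj =
    All.map⁺ (All.tabulate λ y∈xs fx≡fy → All.lookup x∉xs y∈xs (f-inj (here refl) (there y∈xs) fx≡fy))
    ∷ Unique-map-on⁺ xs! λ x∈ y∈ → f-inj (there x∈) (there y∈)

  length-concatMap : ∀ {B : Set} (f : A → List B) xs → length (concatMap f xs) ≡ sum (map (length ∘ f) xs)
  length-concatMap f []       = refl
  length-concatMap f (x ∷ xs) = trans (List.length-++ (f x)) (cong (length (f x) +_) (length-concatMap f xs))

module _ {A B C : Set} (f : A → B → C) where

  length-cartesianProductWith : ∀ xs ys → length (cartesianProductWith f xs ys) ≡ length xs * length ys
  length-cartesianProductWith []       ys = refl
  length-cartesianProductWith (x ∷ xs) ys =
    trans (List.length-++ (map (f x) ys))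
          (cong₂ _+_ (List.length-map (f x) ys) (length-cartesianProductWith xs ys))

  ∈-cartesianProductWith⁺ : ∀ {xs ys x y} → x ∈ xs → y ∈ ys → f x y ∈ cartesianProductWith f xs ys
  ∈-cartesianProductWith⁺ x∈xs y∈ys = Any.cartesianProductWith⁺ f (λ { refl refl → refl }) x∈xs y∈ys

  ∈-cartesianProductWith⁻ : ∀ xs ys {z} → z ∈ cartesianProductWith f xs ys →
                            ∃₂ λ x y → x ∈ xs × y ∈ ys × z ≡ f x y
  ∈-cartesianProductWith⁻ (x ∷ xs) ys z∈ with ∈-++⁻ (map (f x) ys) z∈
  ... | inj₁ z∈fx-ys = let y , y∈ys , z≡fxy = ∈-map⁻ (f x) z∈fx-ys in x , y , here refl , y∈ys , z≡fxy
  ... | inj₂ z∈rest  = let x′ , y , x′∈xs , y∈ys , z≡ = ∈-cartesianProductWith⁻ xs ys z∈rest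
                       in x′ , y , there x′∈xs , y∈ys , z≡

  Unique-cartesianProductWith⁺ : ∀ {xs ys} → Unique xs → Unique ys →
    (∀ {x x′ y y′} → x ∈ xs → x′ ∈ xs → y ∈ ys → y′ ∈ ys → f x y ≡ f x′ y′ → x ≡ x′ × y ≡ y′) →
    Unique (cartesianProductWith f xs ys)
  Unique-cartesianProductWith⁺ [] _ _ = []
  Unique-cartesianProductWith⁺ {x ∷ xs} {ys} (x∉xs ∷ xs!) ys! f-inj =
    Unique.++⁺ (Unique-map-on⁺ ys! λ y∈ y′∈ → proj₂ ∘ f-inj (here refl) (here refl) y∈ y′∈)
               (Unique-cartesianProductWith⁺ xs! ys! λ x∈ x′∈ → f-inj (there x∈) (there x′∈))
               apart
    where
    apart : ∀ {z} → ¬ (z ∈ map (f x) ys × z ∈ cartesianProductWith f xs ys)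
    apart (z∈ , z∈′) with ∈-map⁻ (f x) z∈ | ∈-cartesianProductWith⁻ xs ys z∈′
    ... | y , y∈ys , refl | x′ , y′ , x′∈xs , y′∈ys , fxy≡ =
      All.lookup x∉xs x′∈xs (proj₁ (f-inj (here refl) (there x′∈xs) y∈ys y′∈ys fxy≡))

∈-allSubsets : ∀ {n} (S : Subset n) → S ∈ allSubsets n
∈-allSubsets []          = here refl
∈-allSubsets (true ∷ S)  = ∈-++⁺ˡ (∈-map⁺ (true ∷_) (∈-allSubsets S))
∈-allSubsets (false ∷ S) = ∈-++⁺ʳ (map (true ∷_) (allSubsets _)) (∈-map⁺ (false ∷_) (∈-allSubsets S))

Unique-allSubsets : ∀ n → Unique (allSubsets n)
Unique-allSubsets zero    = [] ∷ []
Unique-allSubsets (suc n) =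
  Unique.++⁺ (Unique.map⁺ (Vec.∷-injectiveʳ) (Unique-allSubsets n))
             (Unique.map⁺ (Vec.∷-injectiveʳ) (Unique-allSubsets n)) apart
  where
  apart : ∀ {S} → ¬ (S ∈ map (true ∷_) (allSubsets n) × S ∈ map (false ∷_) (allSubsets n))
  apart (S∈ , S∈′) with ∈-map⁻ (true ∷_) S∈ | ∈-map⁻ (false ∷_) S∈′
  ... | _ , _ , refl | _ , _ , ()

Canonical : ∀ {n} → List (Subset n) → Set
Canonical {n} τ = τ ∈ sublists (allSubsets n)

canonical-≡ : ∀ {n} {σ σ′ : List (Subset n)} → Canonical σ → Canonical σ′ →
              (∀ {S} → S ∈ σ → S ∈ σ′) → (∀ {S} → S ∈ σ′ → S ∈ σ) → σ ≡ σ′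
canonical-≡ {n} = sublists-≡ (Unique-allSubsets n)

inverseImage : ∀ {m n} → (Subset m → Subset n) → List (Subset n) → List (Subset m)
inverseImage {m} f τ = filterᵇ (λ Y → any (f Y =ˢ_) τ) (allSubsets m)

module _ {m n} {f : Subset m → Subset n} {τ : List (Subset n)} where

  inverseImage-canonical : Canonical (inverseImage f τ)
  inverseImage-canonical = filterᵇ∈sublists _ (allSubsets m)

  ∈-inverseImage⁺ : ∀ {Y} → f Y ∈ τ → Y ∈ inverseImage f τ
  ∈-inverseImage⁺ {Y} fY∈τ =
    ∈-filter⁺ (T? ∘ _) (∈-allSubsets Y) (Any.any⁺ _ (Any.map (λ { refl → =ˢ-refl (f Y) }) fY∈τ))

  ∈-inverseImage⁻ : ∀ {Y} → Y ∈ inverseImage f τ → f Y ∈ τ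
  ∈-inverseImage⁻ Y∈ with find (Any.any⁻ _ τ (proj₂ (∈-filter⁻ (T? ∘ _) {xs = allSubsets m} Y∈)))
  ... | S , S∈τ , fY=S = subst (_∈ τ) (sym (=ˢ⇒≡ fY=S)) S∈τ

normalise : ∀ {n} → List (Subset n) → List (Subset n)
normalise = inverseImage id

normalise-canonical : ∀ {n} (τ : List (Subset n)) → Canonical (normalise τ)
normalise-canonical τ = inverseImage-canonical {f = id} {τ = τ}

∈-normalise⁺ : ∀ {n} {τ : List (Subset n)} {S} → S ∈ τ → S ∈ normalise τ
∈-normalise⁺ = ∈-inverseImage⁺ {f = id}

∈-normalise⁻ : ∀ {n} {τ : List (Subset n)} {S} → S ∈ normalise τ → S ∈ τ
∈-normalise⁻ = ∈-inverseImage⁻ {f = id}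

tubings : ∀ n → Graph n → List (List (Subset n))
tubings n G = filterᵇ (isBinaryTubing G) (sublists (allSubsets n))

NG≡length-tubings : ∀ n G → NG n G ≡ length (tubings n G)
NG≡length-tubings n G = countB≡length-filterᵇ (isBinaryTubing G) (sublists (allSubsets n))

Unique-tubings : ∀ n G → Unique (tubings n G)
Unique-tubings n G = Unique.filter⁺ _ (Unique-sublists (Unique-allSubsets n))

∈-tubings⁻ : ∀ {n G τ} → τ ∈ tubings n G → Canonical τ × BinaryTubing G τ
∈-tubings⁻ τ∈ = let τ-canonical , bt = ∈-filter⁻ (T? ∘ _) τ∈ in τ-canonical , to binaryTubing⇔ bt

∈-tubings⁺ : ∀ {n G τ} → Canonical τ → BinaryTubing G τ → τ ∈ tubings n G
∈-tubings⁺ τ-canonical bt = ∈-filter⁺ (T? ∘ _) τ-canonical (from binaryTubing⇔ bt)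

-- Embeddings and induced subgraphs

module Embedding {m n : ℕ} (φ : Fin m → Fin n) (φ-injective : ∀ {a b} → φ a ≡ φ b → a ≡ b) where

  image : Subset m → Subset n
  image Y = tabulate λ j → any (λ i → lookup Y i ∧ ⌊ φ i Fin.≟ j ⌋) (allFin m)

  preimage : Subset n → Subset m
  preimage X = tabulate λ i → lookup X (φ i)

  InRange : Subset n → Set
  InRange X = ∀ {j} → j ∈ₛ X → ∃ λ i → φ i ≡ j

  ∈-image⁺ : ∀ {Y i} → i ∈ₛ Y → φ i ∈ₛ image Y
  ∈-image⁺ {Y} {i} i∈Y = ∈ₛ-tabulate⁺ (Any.any⁺ _ (Any.map (λ { refl → witness }) (∈-allFin i)))
    where
    witness : T (lookup Y i ∧ ⌊ φ i Fin.≟ φ i ⌋)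
    witness = from T-∧ (∈ₛ⇒T i∈Y , fromWitness refl)

  ∈-image⁻ : ∀ Y {j} → j ∈ₛ image Y → ∃ λ i → i ∈ₛ Y × φ i ≡ j
  ∈-image⁻ Y j∈ with find (Any.any⁻ _ (allFin m) (∈ₛ-tabulate⁻ j∈))
  ... | i , _ , h with to (T-∧ {lookup Y i}) h
  ... | i∈Y , φi≡j = i , T⇒∈ₛ i∈Y , toWitness φi≡j

  φ∈image⁻ : ∀ {Y i} → φ i ∈ₛ image Y → i ∈ₛ Y
  φ∈image⁻ {Y} φi∈ with ∈-image⁻ Y φi∈
  ... | _ , i′∈Y , φi′≡φi = subst (_∈ₛ Y) (φ-injective φi′≡φi) i′∈Y

  ∈-preimage⁺ : ∀ {X i} → φ i ∈ₛ X → i ∈ₛ preimage X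
  ∈-preimage⁺ φi∈X = ∈ₛ-tabulate⁺ (∈ₛ⇒T φi∈X)

  ∈-preimage⁻ : ∀ {X i} → i ∈ₛ preimage X → φ i ∈ₛ X
  ∈-preimage⁻ i∈ = T⇒∈ₛ (∈ₛ-tabulate⁻ i∈)

  image-inRange : ∀ Y → InRange (image Y)
  image-inRange Y j∈ = let i , _ , φi≡j = ∈-image⁻ Y j∈ in i , φi≡j

  image-preimage : ∀ {X} → InRange X → image (preimage X) ≡ X
  image-preimage {X} X-inRange = ⊆-antisym
    (λ j∈ → let i , i∈ , φi≡j = ∈-image⁻ (preimage X) j∈ in subst (_∈ₛ X) φi≡j (∈-preimage⁻ i∈))
    (λ j∈X → let i , φi≡j = X-inRange j∈X
             in subst (_∈ₛ _) φi≡j (∈-image⁺ (∈-preimage⁺ (subst (_∈ₛ X) (sym φi≡j) j∈X))))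

  image-⊆⁺ : ∀ {A B} → A ⊆ B → image A ⊆ image B
  image-⊆⁺ {A} A⊆B j∈ with ∈-image⁻ A j∈
  ... | i , i∈A , refl = ∈-image⁺ (A⊆B i∈A)

  image-⊆⁻ : ∀ {A B} → image A ⊆ image B → A ⊆ B
  image-⊆⁻ ⊆ i∈A = φ∈image⁻ (⊆ (∈-image⁺ i∈A))

  image-injective : ∀ {A B} → image A ≡ image B → A ≡ B
  image-injective eq = ⊆-antisym (image-⊆⁻ (subst (_ ⊆_) eq id)) (image-⊆⁻ (subst (_⊆ _) eq id))

  image-disjoint⁺ : ∀ {A B} → Disjoint A B → Disjoint (image A) (image B)
  image-disjoint⁺ {A} disj j∈A j∈B with ∈-image⁻ A j∈A
  ... | i , i∈A , refl = disj i∈A (φ∈image⁻ j∈B)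

  image-disjoint⁻ : ∀ {A B} → Disjoint (image A) (image B) → Disjoint A B
  image-disjoint⁻ disj i∈A i∈B = disj (∈-image⁺ i∈A) (∈-image⁺ i∈B)

  image-compatible⁺ : ∀ {A B} → Compatible A B → Compatible (image A) (image B)
  image-compatible⁺ = Sum.map image-⊆⁺ (Sum.map image-⊆⁺ image-disjoint⁺)

  image-compatible⁻ : ∀ {A B} → Compatible (image A) (image B) → Compatible A B
  image-compatible⁻ = Sum.map image-⊆⁻ (Sum.map image-⊆⁻ image-disjoint⁻)

  image-∪ : ∀ A B → image (A ∪ B) ≡ image A ∪ image B
  image-∪ A B = ⊆-antisym
    (λ j∈ → let i , i∈A∪B , φi≡j = ∈-image⁻ (A ∪ B) j∈
            in subst (_∈ₛ _) φi≡j (x∈p∪q⁺ (Sum.map ∈-image⁺ ∈-image⁺ (x∈p∪q⁻ A B i∈A∪B))))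
    (λ j∈ → [ image-⊆⁺ {A} (p⊆p∪q B) , image-⊆⁺ {B} (q⊆p∪q A B) ]′ (x∈p∪q⁻ (image A) (image B) j∈))

  image-⁅⁆ : ∀ i → image ⁅ i ⁆ ≡ ⁅ φ i ⁆
  image-⁅⁆ i = ⊆-antisym
    (λ j∈ → let i′ , i′∈ , φi′≡j = ∈-image⁻ ⁅ i ⁆ j∈
            in subst (_∈ₛ ⁅ φ i ⁆) (trans (cong φ (sym (x∈⁅y⁆⇒x≡y i i′∈))) φi′≡j) (x∈⁅x⁆ (φ i)))
    (λ j∈ → subst (_∈ₛ image ⁅ i ⁆) (sym (x∈⁅y⁆⇒x≡y (φ i) j∈)) (∈-image⁺ (x∈⁅x⁆ i)))

  image-singleton⁺ : ∀ {Y} → Singleton Y → Singleton (image Y)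
  image-singleton⁺ (i , refl) = φ i , image-⁅⁆ i

  image-singleton⁻ : ∀ {Y} → Singleton (image Y) → Singleton Y
  image-singleton⁻ {Y} (j , Y′≡⁅j⁆) with ∈-image⁻ Y (subst (j ∈ₛ_) (sym Y′≡⁅j⁆) (x∈⁅x⁆ j))
  ... | i , _ , refl = i , image-injective (trans Y′≡⁅j⁆ (sym (image-⁅⁆ i)))

  module Induced (G : Graph n) (G′ : Graph m) (induced : ∀ i j → G′ i j ≡ G (φ i) (φ j)) where

    image-connected⁺ : ∀ {Y} → Connected G′ Y → Connected G (image Y)
    image-connected⁺ {Y} conn u∈ v∈ {U} closed u∈U with ∈-image⁻ Y u∈ | ∈-image⁻ Y v∈
    ... | _ , u∈Y , refl | _ , v∈Y , refl = ∈-preimage⁻ (conn u∈Y v∈Y closed′ (∈-preimage⁺ u∈U))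
      where
      closed′ : ClosedIn G′ Y (preimage U)
      closed′ i∈Y j∈Y G′ij i∈ =
        ∈-preimage⁺ (closed (∈-image⁺ i∈Y) (∈-image⁺ j∈Y) (subst T (induced _ _) G′ij) (∈-preimage⁻ i∈))

    image-connected⁻ : ∀ {Y} → Connected G (image Y) → Connected G′ Y
    image-connected⁻ {Y} conn u∈Y v∈Y {U} closed u∈U =
      φ∈image⁻ (conn (∈-image⁺ u∈Y) (∈-image⁺ v∈Y) closed′ (∈-image⁺ u∈U))
      where
      closed′ : ClosedIn G (image Y) (image U)
      closed′ i∈ j∈ Gij i∈U with ∈-image⁻ Y i∈ | ∈-image⁻ Y j∈
      ... | _ , i∈Y , refl | _ , j∈Y , refl =
        ∈-image⁺ (closed i∈Y j∈Y (subst T (sym (induced _ _)) Gij) (φ∈image⁻ i∈U))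

    image-tube⁺ : ∀ {Y} → Tube G′ Y → Tube G (image Y)
    image-tube⁺ ((i , i∈Y) , conn) = (φ i , ∈-image⁺ i∈Y) , image-connected⁺ conn

    image-tube⁻ : ∀ {Y} → Tube G (image Y) → Tube G′ Y
    image-tube⁻ {Y} ((j , j∈) , conn) = let i , i∈Y , _ = ∈-image⁻ Y j∈ in (i , i∈Y) , image-connected⁻ conn

    image-binary : ∀ {τ Y} → BinaryTubing G′ τ → Y ∈ τ → Singleton (image Y) ⊎ Partitioned (map image τ) (image Y)
    image-binary bt Y∈τ with BinaryTubing.binary bt Y∈τ
    ... | inj₁ single = inj₁ (image-singleton⁺ single)
    ... | inj₂ (A , B , A∈τ , B∈τ , disj , refl) =
      inj₂ (image A , image B , ∈-map⁺ image A∈τ , ∈-map⁺ image B∈τ , image-disjoint⁺ disj , sym (image-∪ A B))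

    restriction : List (Subset n) → List (Subset m)
    restriction = inverseImage image

    ∈-restriction⁺ : ∀ {τ Y} → image Y ∈ τ → Y ∈ restriction τ
    ∈-restriction⁺ = ∈-inverseImage⁺ {f = image}

    ∈-restriction⁻ : ∀ {τ Y} → Y ∈ restriction τ → image Y ∈ τ
    ∈-restriction⁻ = ∈-inverseImage⁻ {f = image}

    restriction-binaryTubing : ∀ {τ} → BinaryTubing G τ → image full ∈ τ → BinaryTubing G′ (restriction τ)
    restriction-binaryTubing {τ} bt image-full∈τ = record
      { tube   = image-tube⁻ ∘ tube ∘ ∈-restriction⁻
      ; nested = λ X∈ Y∈ → image-compatible⁻ (nested (∈-restriction⁻ X∈) (∈-restriction⁻ Y∈))
      ; full∈  = ∈-restriction⁺ image-full∈τ
      ; binary = λ Y∈ → restrict-binary (binary (∈-restriction⁻ Y∈))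
      }
      where
      open BinaryTubing bt
      restrict-binary : ∀ {Y} → Singleton (image Y) ⊎ Partitioned τ (image Y) → Singleton Y ⊎ Partitioned (restriction τ) Y
      restrict-binary (inj₁ single) = inj₁ (image-singleton⁻ single)
      restrict-binary {Y} (inj₂ (A , B , A∈τ , B∈τ , disj , A∪B≡Y′)) =
        inj₂ (preimage A , preimage B , ∈-restriction⁺ (subst (_∈ τ) (sym A≡) A∈τ) ,
              ∈-restriction⁺ (subst (_∈ τ) (sym B≡) B∈τ) ,
              image-disjoint⁻ (subst₂ Disjoint (sym A≡) (sym B≡) disj) ,
              image-injective (trans (image-∪ (preimage A) (preimage B)) (trans (cong₂ _∪_ A≡ B≡) A∪B≡Y′)))
        where
        A≡ : image (preimage A) ≡ A
        A≡ = image-preimage λ j∈A → image-inRange Y (subst (_ ∈ₛ_) A∪B≡Y′ (x∈p∪q⁺ (inj₁ j∈A)))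
        B≡ : image (preimage B) ≡ B
        B≡ = image-preimage λ j∈B → image-inRange Y (subst (_ ∈ₛ_) A∪B≡Y′ (x∈p∪q⁺ (inj₂ j∈B)))

-- Invariance under isomorphism

module Isomorphism {m n} (f : Fin m ↔ Fin n) (G : Graph n) (G′ : Graph m)
                   (induced : ∀ i j → G′ i j ≡ G (Inverse.to f i) (Inverse.to f j)) where
  open Inverse f using (strictlyInverseˡ; strictlyInverseʳ) renaming (to to φ; from to φ⁻¹)

  φ-injective : ∀ {a b} → φ a ≡ φ b → a ≡ b
  φ-injective {a} {b} eq = trans (sym (strictlyInverseʳ a)) (trans (cong φ⁻¹ eq) (strictlyInverseʳ b))

  open Embedding φ φ-injective
  open Induced G G′ induced

  image-full : image full ≡ full
  image-full = ⊆-antisym (λ _ → ∈⊤) λ {j} _ → subst (_∈ₛ image full) (strictlyInverseˡ j) (∈-image⁺ ∈⊤)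

  transport : List (Subset m) → List (Subset n)
  transport τ = normalise (map image τ)

  transport-binaryTubing : ∀ {τ} → BinaryTubing G′ τ → BinaryTubing G (transport τ)
  transport-binaryTubing {τ} bt =
    BinaryTubing-resp (∈-normalise⁺ {τ = map image τ}) (∈-normalise⁻ {τ = map image τ}) record
    { tube   = λ X∈ → let Y , Y∈τ , X≡ = ∈-map⁻ image X∈ in subst (Tube G) (sym X≡) (image-tube⁺ (tube Y∈τ))
    ; nested = λ X∈ X′∈ → let Y , Y∈τ , X≡ = ∈-map⁻ image X∈ ; Y′ , Y′∈τ , X′≡ = ∈-map⁻ image X′∈
                          in subst₂ Compatible (sym X≡) (sym X′≡) (image-compatible⁺ (nested Y∈τ Y′∈τ))
    ; full∈  = subst (_∈ map image τ) image-full (∈-map⁺ image full∈)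
    ; binary = λ X∈ → let Y , Y∈τ , X≡ = ∈-map⁻ image X∈
                      in subst (λ X → Singleton X ⊎ Partitioned (map image τ) X) (sym X≡) (image-binary bt Y∈τ)
    }
    where open BinaryTubing bt

  transport-injective : ∀ {τ τ′} → Canonical τ → Canonical τ′ → transport τ ≡ transport τ′ → τ ≡ τ′
  transport-injective τ-can τ′-can eq = canonical-≡ τ-can τ′-can (⊆-via eq) (⊆-via (sym eq))
    where
    ⊆-via : ∀ {σ σ′} → transport σ ≡ transport σ′ → ∀ {Y} → Y ∈ σ → Y ∈ σ′
    ⊆-via {σ} {σ′} eq {Y} Y∈σ with ∈-map⁻ image (∈-normalise⁻ {τ = map image σ′} (subst (_ ∈_) eq imageY∈))
      where
      imageY∈ : image Y ∈ transport σ
      imageY∈ = ∈-normalise⁺ {τ = map image σ} (∈-map⁺ image Y∈σ)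
    ... | Y′ , Y′∈σ′ , imageY≡imageY′ = subst (_∈ σ′) (sym (image-injective imageY≡imageY′)) Y′∈σ′

  length-tubings-≤ : length (tubings m G′) ≤ length (tubings n G)
  length-tubings-≤ = subst (_≤ length (tubings n G)) (List.length-map transport (tubings m G′))
    (length-≤ (Unique-map-on⁺ (Unique-tubings m G′) λ τ∈ τ′∈ →
                 transport-injective (proj₁ (∈-tubings⁻ τ∈)) (proj₁ (∈-tubings⁻ τ′∈)))
              transport-tubing)
    where
    transport-tubing : ∀ {σ} → σ ∈ map transport (tubings m G′) → σ ∈ tubings n G
    transport-tubing σ∈ with ∈-map⁻ transport σ∈
    ... | τ , τ∈ , refl = ∈-tubings⁺ (normalise-canonical (map image τ)) (transport-binaryTubing (proj₂ (∈-tubings⁻ τ∈)))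

NG-invariant : ∀ {m n} (f : Fin m ↔ Fin n) (G′ : Graph m) (G : Graph n) →
               (∀ i j → G′ i j ≡ G (Inverse.to f i) (Inverse.to f j)) → NG m G′ ≡ NG n G
NG-invariant {m} {n} f G′ G preserves = begin
  NG m G′               ≡⟨ NG≡length-tubings m G′ ⟩
  length (tubings m G′) ≡⟨ ≤-antisym (Isomorphism.length-tubings-≤ f G G′ preserves)
                                      (Isomorphism.length-tubings-≤ (↔-sym f) G′ G reflects) ⟩
  length (tubings n G)  ≡⟨ sym (NG≡length-tubings n G) ⟩
  NG n G                ∎
  where
  open ≡-Reasoning
  open Inverse f using (strictlyInverseˡ) renaming (from to φ⁻¹)
  reflects : ∀ i j → G i j ≡ G′ (φ⁻¹ i) (φ⁻¹ j)
  reflects i j = sym (trans (preserves (φ⁻¹ i) (φ⁻¹ j)) (cong₂ G (strictlyInverseˡ i) (strictlyInverseˡ j)))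

-- Splitting a graph into two induced subgraphs

module _ {n : ℕ} where

  disjoint-sym : ∀ {A B : Subset n} → Disjoint A B → Disjoint B A
  disjoint-sym disj i∈B i∈A = disj i∈A i∈B

  IsBipartition : Subset n → Subset n → Set
  IsBipartition A B = Disjoint A B × A ∪ B ≡ full

  bipartition-sym : ∀ {A B : Subset n} → IsBipartition A B → IsBipartition B A
  bipartition-sym {A} {B} (disj , A∪B≡full) = disjoint-sym disj , trans (∪-comm B A) A∪B≡full

  bipartition-cover : ∀ {A B : Subset n} → IsBipartition A B → ∀ i → i ∈ₛ A ⊎ i ∈ₛ B
  bipartition-cover {A} {B} (_ , A∪B≡full) i = x∈p∪q⁻ A B (subst (i ∈ₛ_) (sym A∪B≡full) ∈⊤)

  bipartition-⊆ : ∀ {A B C : Subset n} → IsBipartition A B → Disjoint C B → C ⊆ A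
  bipartition-⊆ A∣B disj {i} i∈C = [ id , (λ i∈B → ⊥-elim (disj i∈C i∈B)) ]′ (bipartition-cover A∣B i)

  complement-unique : ∀ {A B B′ : Subset n} → IsBipartition A B → IsBipartition A B′ → B ≡ B′
  complement-unique A∣B A∣B′ =
    ⊆-antisym (bipartition-⊆ (bipartition-sym A∣B′) (disjoint-sym (proj₁ A∣B)))
              (bipartition-⊆ (bipartition-sym A∣B) (disjoint-sym (proj₁ A∣B′)))

  private
    ⊆-part⇒≡ : ∀ {A B A′ B′ : Subset n} → IsBipartition A B → IsBipartition A′ B′ → Nonempty A → Nonempty B′ →
               A ⊆ A′ → Compatible A′ B → A ≡ A′
    ⊆-part⇒≡ (disj , _) _ (a , a∈A) _ A⊆A′ (inj₁ A′⊆B) = ⊥-elim (disj a∈A (A′⊆B (A⊆A′ a∈A)))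
    ⊆-part⇒≡ A∣B (disj′ , _) _ (b′ , b′∈B′) A⊆A′ (inj₂ (inj₁ B⊆A′)) =
      ⊥-elim (disj′ ([ A⊆A′ , B⊆A′ ]′ (bipartition-cover A∣B b′)) b′∈B′)
    ⊆-part⇒≡ A∣B _ _ _ A⊆A′ (inj₂ (inj₂ A′∩B≡∅)) = ⊆-antisym A⊆A′ (bipartition-⊆ A∣B A′∩B≡∅)

  compatible-sym : ∀ {A B : Subset n} → Compatible A B → Compatible B A
  compatible-sym = [ inj₂ ∘ inj₁ , [ inj₁ , inj₂ ∘ inj₂ ∘ disjoint-sym ]′ ]′

  bipartition-unique : ∀ {A B A′ B′ : Subset n} → IsBipartition A B → IsBipartition A′ B′ →
    Nonempty A → Nonempty B → Nonempty A′ → Nonempty B′ →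
    Compatible A A′ → Compatible A B′ → Compatible B A′ → Compatible B B′ →
    (A ≡ A′ × B ≡ B′) ⊎ (A ≡ B′ × B ≡ A′)
  bipartition-unique {A} {B} {A′} {B′} A∣B A′∣B′ A≠∅ B≠∅ A′≠∅ B′≠∅ A~A′ A~B′ B~A′ B~B′ = cases A~A′
    where
    same : A ≡ A′ → (A ≡ A′ × B ≡ B′) ⊎ (A ≡ B′ × B ≡ A′)
    same refl = inj₁ (refl , complement-unique A∣B A′∣B′)
    swapped : A ≡ B′ → (A ≡ A′ × B ≡ B′) ⊎ (A ≡ B′ × B ≡ A′)
    swapped refl = inj₂ (refl , complement-unique A∣B (bipartition-sym A′∣B′))
    cases : Compatible A A′ → (A ≡ A′ × B ≡ B′) ⊎ (A ≡ B′ × B ≡ A′)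
    cases (inj₁ A⊆A′) = same (⊆-part⇒≡ A∣B A′∣B′ A≠∅ B′≠∅ A⊆A′ (compatible-sym B~A′))
    cases (inj₂ (inj₁ A′⊆A)) = same (sym (⊆-part⇒≡ A′∣B′ A∣B A′≠∅ B≠∅ A′⊆A A~B′))
    cases (inj₂ (inj₂ A∩A′≡∅)) = swapped (⊆-part⇒≡ A∣B (bipartition-sym A′∣B′) A≠∅ A′≠∅
                                   (bipartition-⊆ (bipartition-sym A′∣B′) A∩A′≡∅) (compatible-sym B~B′))

  compatible-with-bipartition : ∀ {A B S : Subset n} → IsBipartition A B → Nonempty A → S ≢ full →
                                Compatible S A → Compatible S B → S ⊆ A ⊎ S ⊆ B
  compatible-with-bipartition _ _ _ (inj₁ S⊆A) _ = inj₁ S⊆A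
  compatible-with-bipartition (disj , _) (a , a∈A) _ (inj₂ (inj₁ A⊆S)) (inj₁ S⊆B) = ⊥-elim (disj a∈A (S⊆B (A⊆S a∈A)))
  compatible-with-bipartition A∣B _ S≢full (inj₂ (inj₁ A⊆S)) (inj₂ (inj₁ B⊆S)) =
    ⊥-elim (S≢full (⊆-antisym ⊆⊤ λ {i} _ → [ A⊆S , B⊆S ]′ (bipartition-cover A∣B i)))
  compatible-with-bipartition A∣B _ _ (inj₂ (inj₁ _)) (inj₂ (inj₂ S∩B≡∅)) = inj₁ (bipartition-⊆ A∣B S∩B≡∅)
  compatible-with-bipartition A∣B _ _ (inj₂ (inj₂ S∩A≡∅)) _ = inj₂ (bipartition-⊆ (bipartition-sym A∣B) S∩A≡∅)

  least-element : ∀ {B : Subset n} → Nonempty B → ∃ λ v → v ∈ₛ B × (∀ {j} → toℕ j < toℕ v → j ∉ₛ B)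
  least-element {B} (b , b∈B) with ¬∀⟶∃¬-smallest n (_∉ₛ B) (λ j → ¬? (j ∈? B)) (λ all∉ → all∉ b b∈B)
  ... | v , ¬v∉B , below-∉ = v , decidable-stable (v ∈? B) ¬v∉B , λ {j} j<v →
    subst (_∉ₛ B) (toℕ-injective (trans (toℕ-inject (fromℕ< j<v)) (toℕ-fromℕ< j<v))) (below-∉ (fromℕ< j<v))

full-nontrivial : ∀ {n} → 2 ≤ n → ¬ Singleton (full {n})
full-nontrivial {suc zero} (s≤s ())
full-nontrivial {suc (suc n)} _ (x , full≡⁅x⁆) = 0≢1 (trans (on-x fzero) (sym (on-x (fsuc fzero))))
  where
  on-x : ∀ i → i ≡ x
  on-x i = x∈⁅y⁆⇒x≡y x (subst (i ∈ₛ_) full≡⁅x⁆ ∈⊤)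
  0≢1 : fzero {suc n} ≢ fsuc fzero
  0≢1 ()

record Split {n} (G : Graph n) : Set where
  field
    m₁ m₂        : ℕ
    G₁           : Graph m₁
    G₂           : Graph m₂
    φ₁           : Fin m₁ → Fin n
    φ₂           : Fin m₂ → Fin n
    φ₁-injective : ∀ {a b} → φ₁ a ≡ φ₁ b → a ≡ b
    φ₂-injective : ∀ {a b} → φ₂ a ≡ φ₂ b → a ≡ b
    induced₁     : ∀ i j → G₁ i j ≡ G (φ₁ i) (φ₁ j)
    induced₂     : ∀ i j → G₂ i j ≡ G (φ₂ i) (φ₂ j)
    apart        : ∀ a b → φ₁ a ≢ φ₂ b
    cover        : ∀ j → (∃ λ a → φ₁ a ≡ j) ⊎ (∃ λ b → φ₂ b ≡ j)
    point₁       : Fin m₁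
    point₂       : Fin m₂

  module E₁ = Embedding φ₁ φ₁-injective
  module E₂ = Embedding φ₂ φ₂-injective
  module I₁ = E₁.Induced G G₁ induced₁
  module I₂ = E₂.Induced G G₂ induced₂

  side₁ side₂ : Subset n
  side₁ = E₁.image full
  side₂ = E₂.image full

  images-disjoint : ∀ X Y → Disjoint (E₁.image X) (E₂.image Y)
  images-disjoint X Y j∈ j∈′ with E₁.∈-image⁻ X j∈ | E₂.∈-image⁻ Y j∈′
  ... | a , _ , φ₁a≡j | b , _ , φ₂b≡j = apart a b (trans φ₁a≡j (sym φ₂b≡j))

  sides-bipartition : IsBipartition side₁ side₂
  sides-bipartition = images-disjoint full full , ⊆-antisym ⊆⊤ λ {j} _ → on-a-side j
    where
    on-a-side : ∀ j → j ∈ₛ side₁ ∪ side₂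
    on-a-side j with cover j
    ... | inj₁ (a , refl) = x∈p∪q⁺ (inj₁ (E₁.∈-image⁺ ∈⊤))
    ... | inj₂ (b , refl) = x∈p∪q⁺ (inj₂ (E₂.∈-image⁺ ∈⊤))

  side₁-nonempty : Nonempty side₁
  side₁-nonempty = φ₁ point₁ , E₁.∈-image⁺ ∈⊤

  side₂-nonempty : Nonempty side₂
  side₂-nonempty = φ₂ point₂ , E₂.∈-image⁺ ∈⊤

  SplitsAs : Subset n → Subset n → Set
  SplitsAs A B = (A ≡ side₁ × B ≡ side₂) ⊎ (A ≡ side₂ × B ≡ side₁)

  splitsAs-sym : ∀ {A B} → SplitsAs A B → SplitsAs B A
  splitsAs-sym = Sum.swap ∘ Sum.map Product.swap Product.swap

SameSplit : ∀ {n} {G : Graph n} → Split G → Split G → Set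
SameSplit c c′ = Split.SplitsAs c′ (Split.side₁ c) (Split.side₂ c)

module Gluing {n} {G : Graph n} (G-connected : Connected G full) (c : Split G) where
  open Split c

  glue : List (Subset m₁) → List (Subset m₂) → List (Subset n)
  glue τ₁ τ₂ = full ∷ map E₁.image τ₁ ++ map E₂.image τ₂

  combine : List (Subset m₁) → List (Subset m₂) → List (Subset n)
  combine τ₁ τ₂ = normalise (glue τ₁ τ₂)

  module _ {τ₁ : List (Subset m₁)} {τ₂ : List (Subset m₂)} where

    ∈-glue₁⁺ : ∀ {Y} → Y ∈ τ₁ → E₁.image Y ∈ glue τ₁ τ₂
    ∈-glue₁⁺ Y∈ = there (∈-++⁺ˡ (∈-map⁺ E₁.image Y∈))

    ∈-glue₂⁺ : ∀ {Y} → Y ∈ τ₂ → E₂.image Y ∈ glue τ₁ τ₂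
    ∈-glue₂⁺ Y∈ = there (∈-++⁺ʳ (map E₁.image τ₁) (∈-map⁺ E₂.image Y∈))

    data GlueMember : Subset n → Set where
      whole : GlueMember full
      left  : ∀ {Y} → Y ∈ τ₁ → GlueMember (E₁.image Y)
      right : ∀ {Y} → Y ∈ τ₂ → GlueMember (E₂.image Y)

    ∈-glue⁻ : ∀ {X} → X ∈ glue τ₁ τ₂ → GlueMember X
    ∈-glue⁻ (here refl) = whole
    ∈-glue⁻ (there X∈) with ∈-++⁻ (map E₁.image τ₁) X∈
    ... | inj₁ X∈₁ = let Y , Y∈ , X≡ = ∈-map⁻ E₁.image X∈₁ in subst GlueMember (sym X≡) (left Y∈)
    ... | inj₂ X∈₂ = let Y , Y∈ , X≡ = ∈-map⁻ E₂.image X∈₂ in subst GlueMember (sym X≡) (right Y∈)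

    glue-binaryTubing : BinaryTubing G₁ τ₁ → BinaryTubing G₂ τ₂ → BinaryTubing G (glue τ₁ τ₂)
    glue-binaryTubing bt₁ bt₂ = record
      { tube   = tube ∘ ∈-glue⁻
      ; nested = λ X∈ Y∈ → nested (∈-glue⁻ X∈) (∈-glue⁻ Y∈)
      ; full∈  = here refl
      ; binary = binary ∘ ∈-glue⁻
      }
      where
      module T₁ = BinaryTubing bt₁
      module T₂ = BinaryTubing bt₂
      tube : ∀ {X} → GlueMember X → Tube G X
      tube whole      = (φ₁ point₁ , ∈⊤) , G-connected
      tube (left Y∈)  = I₁.image-tube⁺ (T₁.tube Y∈)
      tube (right Y∈) = I₂.image-tube⁺ (T₂.tube Y∈)
      nested : ∀ {X Y} → GlueMember X → GlueMember Y → Compatible X Y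
      nested whole      _          = inj₂ (inj₁ ⊆⊤)
      nested (left _)   whole      = inj₁ ⊆⊤
      nested (right _)  whole      = inj₁ ⊆⊤
      nested (left X∈)  (left Y∈)  = E₁.image-compatible⁺ (T₁.nested X∈ Y∈)
      nested (right X∈) (right Y∈) = E₂.image-compatible⁺ (T₂.nested X∈ Y∈)
      nested (left {X} _)  (right {Y} _) = inj₂ (inj₂ (images-disjoint X Y))
      nested (right {X} _) (left {Y} _)  = inj₂ (inj₂ (disjoint-sym (images-disjoint Y X)))
      binary : ∀ {X} → GlueMember X → Singleton X ⊎ Partitioned (glue τ₁ τ₂) X
      binary whole = inj₂ (side₁ , side₂ , ∈-glue₁⁺ T₁.full∈ , ∈-glue₂⁺ T₂.full∈ , sides-bipartition)
      binary (left Y∈) = Sum.map₂ (Partitioned-mono λ Z∈ → there (∈-++⁺ˡ Z∈)) (I₁.image-binary bt₁ Y∈)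
      binary (right Y∈) = Sum.map₂ (Partitioned-mono λ Z∈ → there (∈-++⁺ʳ _ Z∈)) (I₂.image-binary bt₂ Y∈)

    ∈-glue₁⁻ : ∀ {Y} → Nonempty Y → E₁.image Y ∈ glue τ₁ τ₂ → Y ∈ τ₁
    ∈-glue₁⁻ {Y} (y , y∈Y) Y′∈ = from-member (∈-glue⁻ Y′∈) refl
      where
      from-member : ∀ {X} → GlueMember X → X ≡ E₁.image Y → Y ∈ τ₁
      from-member whole         eq = ⊥-elim (images-disjoint Y full (subst (_ ∈ₛ_) eq ∈⊤) (E₂.∈-image⁺ (∈⊤ {x = point₂})))
      from-member (left Y′∈)    eq = subst (_∈ τ₁) (E₁.image-injective eq) Y′∈
      from-member (right {Y′} _) eq =
        ⊥-elim (images-disjoint Y Y′ (E₁.∈-image⁺ y∈Y) (subst (_ ∈ₛ_) (sym eq) (E₁.∈-image⁺ y∈Y)))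

    ∈-glue₂⁻ : ∀ {Y} → Nonempty Y → E₂.image Y ∈ glue τ₁ τ₂ → Y ∈ τ₂
    ∈-glue₂⁻ {Y} (y , y∈Y) Y′∈ = from-member (∈-glue⁻ Y′∈) refl
      where
      from-member : ∀ {X} → GlueMember X → X ≡ E₂.image Y → Y ∈ τ₂
      from-member whole          eq = ⊥-elim (images-disjoint full Y (E₁.∈-image⁺ (∈⊤ {x = point₁})) (subst (_ ∈ₛ_) eq ∈⊤))
      from-member (left {Y′} _)  eq =
        ⊥-elim (images-disjoint Y′ Y (subst (_ ∈ₛ_) (sym eq) (E₂.∈-image⁺ y∈Y)) (E₂.∈-image⁺ y∈Y))
      from-member (right Y′∈)    eq = subst (_∈ τ₂) (E₂.image-injective eq) Y′∈

  combine-injective : ∀ {σ₁ σ₁′ σ₂ σ₂′} →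
    σ₁ ∈ tubings m₁ G₁ → σ₁′ ∈ tubings m₁ G₁ → σ₂ ∈ tubings m₂ G₂ → σ₂′ ∈ tubings m₂ G₂ →
    combine σ₁ σ₂ ≡ combine σ₁′ σ₂′ → σ₁ ≡ σ₁′ × σ₂ ≡ σ₂′
  combine-injective {σ₁} {σ₁′} {σ₂} {σ₂′} σ₁∈ σ₁′∈ σ₂∈ σ₂′∈ eq =
    canonical-≡ (proj₁ (∈-tubings⁻ σ₁∈)) (proj₁ (∈-tubings⁻ σ₁′∈))
                (left-⊆ {ρ₂ = σ₂} {σ₂′} (proj₂ (∈-tubings⁻ σ₁∈)) eq)
                (left-⊆ {ρ₂ = σ₂′} {σ₂} (proj₂ (∈-tubings⁻ σ₁′∈)) (sym eq)) ,
    canonical-≡ (proj₁ (∈-tubings⁻ σ₂∈)) (proj₁ (∈-tubings⁻ σ₂′∈))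
                (right-⊆ {σ₁} {σ₁′} (proj₂ (∈-tubings⁻ σ₂∈)) eq)
                (right-⊆ {σ₁′} {σ₁} (proj₂ (∈-tubings⁻ σ₂′∈)) (sym eq))
    where
    left-⊆ : ∀ {ρ₁ ρ₁′ ρ₂ ρ₂′} → BinaryTubing G₁ ρ₁ → combine ρ₁ ρ₂ ≡ combine ρ₁′ ρ₂′ →
             ∀ {Y} → Y ∈ ρ₁ → Y ∈ ρ₁′
    left-⊆ {ρ₁} {ρ₁′} {ρ₂} {ρ₂′} bt eq Y∈ =
      ∈-glue₁⁻ (proj₁ (BinaryTubing.tube bt Y∈)) (∈-normalise⁻ {τ = glue ρ₁′ ρ₂′}
        (subst (_ ∈_) eq (∈-normalise⁺ {τ = glue ρ₁ ρ₂} (∈-glue₁⁺ Y∈))))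
    right-⊆ : ∀ {ρ₁ ρ₁′ ρ₂ ρ₂′} → BinaryTubing G₂ ρ₂ → combine ρ₁ ρ₂ ≡ combine ρ₁′ ρ₂′ →
              ∀ {Y} → Y ∈ ρ₂ → Y ∈ ρ₂′
    right-⊆ {ρ₁} {ρ₁′} {ρ₂} {ρ₂′} bt eq Y∈ =
      ∈-glue₂⁻ (proj₁ (BinaryTubing.tube bt Y∈)) (∈-normalise⁻ {τ = glue ρ₁′ ρ₂′}
        (subst (_ ∈_) eq (∈-normalise⁺ {τ = glue ρ₁ ρ₂} (∈-glue₂⁺ Y∈))))

  tubingsThrough : List (List (Subset n))
  tubingsThrough = cartesianProductWith combine (tubings m₁ G₁) (tubings m₂ G₂)

  length-tubingsThrough : length tubingsThrough ≡ length (tubings m₁ G₁) * length (tubings m₂ G₂)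
  length-tubingsThrough = length-cartesianProductWith combine (tubings m₁ G₁) (tubings m₂ G₂)

  Unique-tubingsThrough : Unique tubingsThrough
  Unique-tubingsThrough =
    Unique-cartesianProductWith⁺ combine (Unique-tubings m₁ G₁) (Unique-tubings m₂ G₂) combine-injective

  ∈-tubingsThrough⁻ : ∀ {τ} → τ ∈ tubingsThrough → τ ∈ tubings n G × side₁ ∈ τ × side₂ ∈ τ
  ∈-tubingsThrough⁻ τ∈ with ∈-cartesianProductWith⁻ combine (tubings m₁ G₁) (tubings m₂ G₂) τ∈
  ... | τ₁ , τ₂ , τ₁∈ , τ₂∈ , refl =
    ∈-tubings⁺ (normalise-canonical (glue τ₁ τ₂))
      (BinaryTubing-resp (∈-normalise⁺ {τ = glue τ₁ τ₂}) (∈-normalise⁻ {τ = glue τ₁ τ₂})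
        (glue-binaryTubing bt₁ bt₂)) ,
    ∈-normalise⁺ {τ = glue τ₁ τ₂} (∈-glue₁⁺ (BinaryTubing.full∈ bt₁)) ,
    ∈-normalise⁺ {τ = glue τ₁ τ₂} (∈-glue₂⁺ (BinaryTubing.full∈ bt₂))
    where
    bt₁ = proj₂ (∈-tubings⁻ τ₁∈)
    bt₂ = proj₂ (∈-tubings⁻ τ₂∈)

  -- A tubing containing both sides is glued from its restrictions to the two sides.
  ∈-tubingsThrough⁺ : ∀ {τ} → τ ∈ tubings n G → side₁ ∈ τ → side₂ ∈ τ → τ ∈ tubingsThrough
  ∈-tubingsThrough⁺ {τ} τ∈ side₁∈τ side₂∈τ =
    subst (_∈ tubingsThrough) τ≡ (∈-cartesianProductWith⁺ combine τ₁∈ τ₂∈)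
    where
    τ-canonical = proj₁ (∈-tubings⁻ τ∈)
    bt = proj₂ (∈-tubings⁻ τ∈)
    open BinaryTubing bt
    τ₁∈ : I₁.restriction τ ∈ tubings m₁ G₁
    τ₁∈ = ∈-tubings⁺ (inverseImage-canonical {f = E₁.image} {τ = τ}) (I₁.restriction-binaryTubing bt side₁∈τ)
    τ₂∈ : I₂.restriction τ ∈ tubings m₂ G₂
    τ₂∈ = ∈-tubings⁺ (inverseImage-canonical {f = E₂.image} {τ = τ}) (I₂.restriction-binaryTubing bt side₂∈τ)
    glued⊆τ : ∀ {S} → GlueMember {I₁.restriction τ} {I₂.restriction τ} S → S ∈ τ
    glued⊆τ whole      = full∈
    glued⊆τ (left Y∈)  = I₁.∈-restriction⁻ Y∈
    glued⊆τ (right Y∈) = I₂.∈-restriction⁻ Y∈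
    glued = glue (I₁.restriction τ) (I₂.restriction τ)
    τ⊆glued : ∀ {S} → S ∈ τ → S ∈ glued
    τ⊆glued {S} S∈τ with ≡-dec Bool._≟_ S full
    ... | yes refl = here refl
    ... | no S≢full with compatible-with-bipartition sides-bipartition side₁-nonempty S≢full
                           (nested S∈τ side₁∈τ) (nested S∈τ side₂∈τ)
    ... | inj₁ S⊆side₁ = let S≡ = E₁.image-preimage {S} (E₁.image-inRange full ∘ S⊆side₁) in
      subst (_∈ glued) S≡ (∈-glue₁⁺ {Y = E₁.preimage S} (I₁.∈-restriction⁺ (subst (_∈ τ) (sym S≡) S∈τ)))
    ... | inj₂ S⊆side₂ = let S≡ = E₂.image-preimage {S} (E₂.image-inRange full ∘ S⊆side₂) in
      subst (_∈ glued) S≡ (∈-glue₂⁺ {Y = E₂.preimage S} (I₂.∈-restriction⁺ (subst (_∈ τ) (sym S≡) S∈τ)))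
    τ≡ : combine (I₁.restriction τ) (I₂.restriction τ) ≡ τ
    τ≡ = canonical-≡ (normalise-canonical glued) τ-canonical
           (glued⊆τ ∘ ∈-glue⁻ ∘ ∈-normalise⁻ {τ = glued}) (∈-normalise⁺ {τ = glued} ∘ τ⊆glued)

module Splitting {n} {G : Graph n} (G-connected : Connected G full) (nontrivial : ¬ Singleton (full {n})) where
  open Split
  open Gluing G-connected

  tubingsThrough-disjoint : ∀ {c c′ τ} → ¬ SameSplit c c′ → τ ∈ tubingsThrough c → τ ∈ tubingsThrough c′ → ⊥
  tubingsThrough-disjoint {c} {c′} different τ∈ τ∈′
    with ∈-tubingsThrough⁻ c τ∈ | ∈-tubingsThrough⁻ c′ τ∈′
  ... | τ∈tubings , A∈ , B∈ | _ , A′∈ , B′∈ =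
    different (bipartition-unique (sides-bipartition c) (sides-bipartition c′)
      (side₁-nonempty c) (side₂-nonempty c) (side₁-nonempty c′) (side₂-nonempty c′)
      (nested A∈ A′∈) (nested A∈ B′∈) (nested B∈ A′∈) (nested B∈ B′∈))
    where open BinaryTubing (proj₂ (∈-tubings⁻ τ∈tubings))

  length-tubings-by-splits : (ss : List (Split G)) → AllPairs (λ c c′ → ¬ SameSplit c c′) ss →
    (∀ {A B} → Tube G A → Tube G B → IsBipartition A B → Any (λ c → SplitsAs c A B) ss) →
    length (tubings n G) ≡ sum (map (λ c → length (tubings (m₁ c) (G₁ c)) * length (tubings (m₂ c) (G₂ c))) ss)
  length-tubings-by-splits ss distinct complete = begin
    length (tubings n G)                       ≡⟨ length-≡ (Unique-tubings n G) Unique-glued tubings⊆glued glued⊆tubings ⟩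
    length (concatMap tubingsThrough ss)       ≡⟨ length-concatMap tubingsThrough ss ⟩
    sum (map (length ∘ tubingsThrough) ss)     ≡⟨ cong sum (List.map-cong length-tubingsThrough ss) ⟩
    sum (map (λ c → length (tubings (m₁ c) (G₁ c)) * length (tubings (m₂ c) (G₂ c))) ss) ∎
    where
    open ≡-Reasoning
    Unique-glued : Unique (concatMap tubingsThrough ss)
    Unique-glued = Unique.concat⁺ (All.map⁺ (All.tabulate λ {c} _ → Unique-tubingsThrough c))
      (AllPairs.map⁺ (AllPairs.map (λ {c} {c′} different {_} (τ∈ , τ∈′) →
                                      tubingsThrough-disjoint {c} {c′} different τ∈ τ∈′) distinct))
    glued⊆tubings : ∀ {τ} → τ ∈ concatMap tubingsThrough ss → τ ∈ tubings n G
    glued⊆tubings τ∈ = let c , τ∈′ = satisfied (∈-concatMap⁻ tubingsThrough {xs = ss} τ∈)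
                       in proj₁ (∈-tubingsThrough⁻ c τ∈′)
    tubings⊆glued : ∀ {τ} → τ ∈ tubings n G → τ ∈ concatMap tubingsThrough ss
    tubings⊆glued {τ} τ∈ = split-full (binary full∈)
      where
      open BinaryTubing (proj₂ (∈-tubings⁻ τ∈))
      split-full : Singleton full ⊎ Partitioned τ full → τ ∈ concatMap tubingsThrough ss
      split-full (inj₁ single) = ⊥-elim (nontrivial single)
      split-full (inj₂ (A , B , A∈τ , B∈τ , A∣B)) = ∈-concatMap⁺ tubingsThrough
        (Any.map (λ { {c} (inj₁ (refl , refl)) → ∈-tubingsThrough⁺ c τ∈ A∈τ B∈τ
                    ; {c} (inj₂ (refl , refl)) → ∈-tubingsThrough⁺ c τ∈ B∈τ A∈τ })
                 (complete (tube A∈τ) (tube B∈τ) A∣B))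

Edge : Set
Edge = ℕ × ℕ

edges : RTree → List Edge
edges t = edgesFrom 0 t

onEdge : (ℕ → ℕ) → Edge → Edge
onEdge f = Product.map f f

Between : ℕ → ℕ → ℕ → Set
Between lo hi x = lo ≤ x × x < hi

between-widen : ∀ {lo lo′ hi hi′ x} → lo′ ≤ lo → hi ≤ hi′ → Between lo hi x → Between lo′ hi′ x
between-widen lo′≤lo hi≤hi′ (lo≤x , x<hi) = ≤-trans lo′≤lo lo≤x , <-≤-trans x<hi hi≤hi′

root : ∀ t → Fin (size t)
root (node _) = fzero

toℕ-root : ∀ t → toℕ (root t) ≡ 0
toℕ-root (node _) = refl

size>0 : ∀ t → 0 < size t
size>0 (node _) = s≤s z≤n

mutual
  edgesFrom-between : ∀ k t {x y} → (x , y) ∈ edgesFrom k t →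
                      Between k (k + size t) x × Between k (k + size t) y
  edgesFrom-between k (node ts) e∈ with childEdges-between k (suc k) ts e∈
  ... | x-bound , y-between = Sum.[ (λ { refl → ≤-refl , m<m+n k (s≤s z≤n) }) , widen ]′ x-bound , widen y-between
    where
    widen : ∀ {x} → Between (suc k) (suc k + sizes ts) x → Between k (k + size (node ts)) x
    widen = between-widen (n≤1+n k) (≤-reflexive (sym (+-suc k (sizes ts))))

  childEdges-between : ∀ r o ts {x y} → (x , y) ∈ childEdges r o ts →
                       (x ≡ r ⊎ Between o (o + sizes ts) x) × Between o (o + sizes ts) y
  childEdges-between r o (s ∷ ss) (here refl) =
    inj₁ refl , ≤-refl , m<m+n o (<-≤-trans (size>0 s) (m≤m+n (size s) (sizes ss)))
  childEdges-between r o (s ∷ ss) (there e∈) with ∈-++⁻ (edgesFrom o s) e∈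
  ... | inj₁ e∈s = let x-between , y-between = edgesFrom-between o s e∈s
                   in inj₂ (widen₁ x-between) , widen₁ y-between
    where
    widen₁ : ∀ {x} → Between o (o + size s) x → Between o (o + sizes (s ∷ ss)) x
    widen₁ = between-widen ≤-refl (≤-trans (m≤m+n (o + size s) (sizes ss)) (≤-reflexive (+-assoc o (size s) (sizes ss))))
  ... | inj₂ e∈ss = let x-bound , y-between = childEdges-between r (o + size s) ss e∈ss
                    in Sum.map₂ widen₂ x-bound , widen₂ y-between
    where
    widen₂ : ∀ {x} → Between (o + size s) (o + size s + sizes ss) x → Between o (o + sizes (s ∷ ss)) x
    widen₂ = between-widen (m≤m+n o (size s)) (≤-reflexive (+-assoc o (size s) (sizes ss)))

mutual
  shift-edgesFrom : ∀ k a t → map (onEdge (_+ k)) (edgesFrom a t) ≡ edgesFrom (a + k) t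
  shift-edgesFrom k a (node ts) = shift-childEdges k a (suc a) ts

  shift-childEdges : ∀ k r o ts → map (onEdge (_+ k)) (childEdges r o ts) ≡ childEdges (r + k) (o + k) ts
  shift-childEdges k r o []       = refl
  shift-childEdges k r o (s ∷ ss) = cong ((r + k , o + k) ∷_) (begin
    map (onEdge (_+ k)) (edgesFrom o s ++ childEdges r (o + size s) ss)
      ≡⟨ List.map-++ (onEdge (_+ k)) (edgesFrom o s) _ ⟩
    map (onEdge (_+ k)) (edgesFrom o s) ++ map (onEdge (_+ k)) (childEdges r (o + size s) ss)
      ≡⟨ cong₂ _++_ (shift-edgesFrom k o s) (shift-childEdges k r (o + size s) ss) ⟩
    edgesFrom (o + k) s ++ childEdges (r + k) (o + size s + k) ss
      ≡⟨ cong (λ o′ → edgesFrom (o + k) s ++ childEdges (r + k) o′ ss) (+-right-comm o (size s) k) ⟩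
    edgesFrom (o + k) s ++ childEdges (r + k) (o + k + size s) ss ∎)
    where open ≡-Reasoning

-- The label in t of a vertex of the upper tree of a cut: the k labels of the lower tree are
-- inserted at o.
gap : ℕ → ℕ → ℕ → ℕ
gap o k x with x <? o
... | yes _ = x
... | no  _ = x + k

gap-< : ∀ {o k x} → x < o → gap o k x ≡ x
gap-< {o} {k} {x} x<o with x <? o
... | yes _   = refl
... | no  x≮o = ⊥-elim (x≮o x<o)

gap-≥ : ∀ {o k x} → o ≤ x → gap o k x ≡ x + k
gap-≥ {o} {k} {x} o≤x with x <? o
... | yes x<o = ⊥-elim (<⇒≱ x<o o≤x)
... | no  _   = refl

gap-gap : ∀ {o c k M} → o ≤ c → c ≤ o + M → ∀ x → gap c k (gap o M x) ≡ gap o (M + k) x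
gap-gap {o} {c} {k} {M} o≤c c≤o+M x with x <? o
... | yes x<o = gap-< (<-≤-trans x<o o≤c)
... | no  x≮o = trans (gap-≥ (≤-trans c≤o+M (+-monoˡ-≤ M (≮⇒≥ x≮o)))) (+-assoc x M k)

gap-edges-gap : ∀ {o c k M} → o ≤ c → c ≤ o + M → ∀ L →
                map (onEdge (gap c k)) (map (onEdge (gap o M)) L) ≡ map (onEdge (gap o (M + k))) L
gap-edges-gap o≤c c≤o+M L = trans (sym (List.map-∘ L))
  (List.map-cong (λ (x , y) → cong₂ _,_ (gap-gap o≤c c≤o+M x) (gap-gap o≤c c≤o+M y)) L)

gap-edgesFrom-above : ∀ {c k o} s → c ≤ o → map (onEdge (gap c k)) (edgesFrom o s) ≡ edgesFrom (o + k) s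
gap-edgesFrom-above {c} {k} {o} s c≤o = trans (List.map-cong-local (All.tabulate as-shift)) (shift-edgesFrom k o s)
  where
  as-shift : ∀ {e} → e ∈ edgesFrom o s → onEdge (gap c k) e ≡ onEdge (_+ k) e
  as-shift e∈ with edgesFrom-between o s e∈
  ... | (o≤x , _) , (o≤y , _) = cong₂ _,_ (gap-≥ (≤-trans c≤o o≤x)) (gap-≥ (≤-trans c≤o o≤y))

gap-edgesFrom-below : ∀ {c k o} s → o + size s ≤ c → map (onEdge (gap c k)) (edgesFrom o s) ≡ edgesFrom o s
gap-edgesFrom-below {c} {k} {o} s o+s≤c = List.map-id-local (All.tabulate fixed)
  where
  fixed : ∀ {e} → e ∈ edgesFrom o s → onEdge (gap c k) e ≡ e
  fixed e∈ with edgesFrom-between o s e∈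
  ... | (_ , x<) , (_ , y<) = cong₂ _,_ (gap-< (<-≤-trans x< o+s≤c)) (gap-< (<-≤-trans y< o+s≤c))

gap-childEdges : ∀ {c k r o} ss → r < c → c ≤ o → map (onEdge (gap c k)) (childEdges r o ss) ≡ childEdges r (o + k) ss
gap-childEdges [] _ _ = refl
gap-childEdges {c} {k} {r} {o} (s ∷ ss) r<c c≤o = cong₂ _∷_ (cong₂ _,_ (gap-< r<c) (gap-≥ c≤o)) (begin
  map (onEdge (gap c k)) (edgesFrom o s ++ childEdges r (o + size s) ss)
    ≡⟨ List.map-++ (onEdge (gap c k)) (edgesFrom o s) _ ⟩
  map (onEdge (gap c k)) (edgesFrom o s) ++ map (onEdge (gap c k)) (childEdges r (o + size s) ss)
    ≡⟨ cong₂ _++_ (gap-edgesFrom-above s c≤o) (gap-childEdges ss r<c (≤-trans c≤o (m≤m+n o (size s)))) ⟩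
  edgesFrom (o + k) s ++ childEdges r (o + size s + k) ss
    ≡⟨ cong (λ o′ → edgesFrom (o + k) s ++ childEdges r o′ ss) (+-right-comm o (size s) k) ⟩
  edgesFrom (o + k) s ++ childEdges r (o + k + size s) ss ∎)
  where open ≡-Reasoning

-- Cuts of a rooted tree

range : ℕ → ℕ → List ℕ
range a zero    = []
range a (suc k) = a ∷ range (suc a) k

range-++ : ∀ a x y → range a (x + y) ≡ range a x ++ range (a + x) y
range-++ a zero    y = cong (λ a′ → range a′ y) (sym (+-identityʳ a))
range-++ a (suc x) y = cong (a ∷_) (trans (range-++ (suc a) x y) (cong (λ a′ → range (suc a) x ++ range a′ y) (sym (+-suc a x))))

∈-range⁺ : ∀ {a k x} → Between a (a + k) x → x ∈ range a k
∈-range⁺ {a} {zero}  (a≤x , x<a+0) = ⊥-elim (<⇒≱ x<a+0 (subst (_≤ _) (sym (+-identityʳ a)) a≤x))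
∈-range⁺ {a} {suc k} {x} (a≤x , x<) with a Nat.≟ x
... | yes refl = here refl
... | no  a≢x  = there (∈-range⁺ (≤∧≢⇒< a≤x a≢x , subst (x <_) (+-suc a k) x<))

∈-range⁻ : ∀ {a k x} → x ∈ range a k → a ≤ x
∈-range⁻ {a} {suc k} (here refl) = ≤-refl
∈-range⁻ {a} {suc k} (there x∈)  = ≤-trans (n≤1+n a) (∈-range⁻ x∈)

Unique-range : ∀ a k → Unique (range a k)
Unique-range a zero    = []
Unique-range a (suc k) = All.tabulate (λ x∈ a≡x → <⇒≱ (n<1+n a) (subst (suc a ≤_) (sym a≡x) (∈-range⁻ x∈)))
                         ∷ Unique-range (suc a) k

-- Removing the edge above the subtree `lower` of t: the vertices of `lower` carry the labels
-- offset, …, offset + size lower - 1 in t, and `parent` is the label of the other endpoint.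
record Cut (t : RTree) : Set where
  field
    lower upper   : RTree
    offset parent : ℕ
    parent<offset : parent < offset
    lower-fits    : offset + size lower ≤ size t
    size-sum      : size lower + size upper ≡ size t
    edges-split   : edges t ↭ map (onEdge (gap offset (size lower))) (edges upper)
                              ++ (parent , offset) ∷ map (onEdge (_+ offset)) (edges lower)

  pieces : RTree × RTree
  pieces = lower , upper

-- ctx ts hangs the trees ts as children below the vertex labelled r, the first of them at
-- label o; O lists the edges of ctx [] and B is its size.
record Context (ctx : List RTree → RTree) (r o : ℕ) (O : List Edge) (B : ℕ) : Set where
  field
    edges-ctx    : ∀ ts → edges (ctx ts) ↭ map (onEdge (gap o (sizes ts))) O ++ childEdges r o ts
    size-ctx     : ∀ ts → size (ctx ts) ≡ B + sizes ts
    parent<first : r < o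
    first≤base   : o ≤ B

module _ {ctx r o O B} (C : Context ctx r o O B) (s : RTree) (ss : List RTree) where
  open Context C
  private
    k = size s
    M = sizes ss

  private
    x  = (r , o)
    ρ  = map (onEdge (gap o (k + M))) O
    A  = edgesFrom o s
    Cs = childEdges r (o + k) ss

  first-cut-fits : o + k ≤ size (ctx (s ∷ ss))
  first-cut-fits = begin
    o + k               ≤⟨ +-monoˡ-≤ k first≤base ⟩
    B + k               ≤⟨ m≤m+n (B + k) M ⟩
    B + k + M           ≡⟨ +-assoc B k M ⟩
    B + (k + M)         ≡⟨ size-ctx (s ∷ ss) ⟨
    size (ctx (s ∷ ss)) ∎
    where open ≤-Reasoning

  first-cut-size : k + size (ctx ss) ≡ size (ctx (s ∷ ss))
  first-cut-size = begin
    k + size (ctx ss)   ≡⟨ cong (k +_) (size-ctx ss) ⟩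
    k + (B + M)         ≡⟨ +-left-comm k B M ⟩
    B + (k + M)         ≡⟨ size-ctx (s ∷ ss) ⟨
    size (ctx (s ∷ ss)) ∎
    where open ≡-Reasoning

  first-cut-upper : map (onEdge (gap o k)) (edges (ctx ss)) ↭ ρ ++ Cs
  first-cut-upper = begin
    map (onEdge (gap o k)) (edges (ctx ss))
      ↭⟨ ↭.map⁺ _ (edges-ctx ss) ⟩
    map (onEdge (gap o k)) (map (onEdge (gap o M)) O ++ childEdges r o ss)
      ≡⟨ List.map-++ (onEdge (gap o k)) (map (onEdge (gap o M)) O) _ ⟩
    map (onEdge (gap o k)) (map (onEdge (gap o M)) O) ++ map (onEdge (gap o k)) (childEdges r o ss)
      ≡⟨ cong₂ _++_ (trans (gap-edges-gap ≤-refl (m≤m+n o M) O) (cong (λ w → map (onEdge (gap o w)) O) (+-comm M k)))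
                    (gap-childEdges ss parent<first ≤-refl) ⟩
    ρ ++ Cs ∎
    where open PermutationReasoning

  first-cut-edges : edges (ctx (s ∷ ss)) ↭ map (onEdge (gap o k)) (edges (ctx ss)) ++ x ∷ map (onEdge (_+ o)) (edges s)
  first-cut-edges = begin
    edges (ctx (s ∷ ss))                              ↭⟨ edges-ctx (s ∷ ss) ⟩
    ρ ++ (x ∷ A) ++ Cs                                ↭⟨ ↭.++⁺ˡ ρ (↭.++-comm (x ∷ A) Cs) ⟩
    ρ ++ Cs ++ x ∷ A                                  ≡⟨ List.++-assoc ρ Cs (x ∷ A) ⟨
    (ρ ++ Cs) ++ x ∷ A                                ↭⟨ ↭.++⁺ʳ (x ∷ A) first-cut-upper ⟨
    upper-edges ++ x ∷ A                              ≡⟨ cong (λ A′ → upper-edges ++ x ∷ A′) (shift-edgesFrom o 0 s) ⟨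
    upper-edges ++ x ∷ map (onEdge (_+ o)) (edges s)  ∎
    where
    open PermutationReasoning
    upper-edges = map (onEdge (gap o k)) (edges (ctx ss))

  first-cut : Cut (ctx (s ∷ ss))
  first-cut = record
    { lower = s ; upper = ctx ss ; offset = o ; parent = r ; parent<offset = parent<first
    ; lower-fits = first-cut-fits ; size-sum = first-cut-size ; edges-split = first-cut-edges }

  next-sibling : Context (λ ss′ → ctx (s ∷ ss′)) r (o + k) (map (onEdge (gap o k)) O ++ x ∷ A) (B + k)
  next-sibling = record
    { edges-ctx    = λ ss′ → ↭-trans (edges-ctx (s ∷ ss′)) (↭-reflexive (edges-eq ss′))
    ; size-ctx     = λ ss′ → trans (size-ctx (s ∷ ss′)) (sym (+-assoc B k (sizes ss′)))
    ; parent<first = <-≤-trans parent<first (m≤m+n o k)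
    ; first≤base   = +-monoˡ-≤ k first≤base
    }
    where
    outer-eq : ∀ M′ → map (onEdge (gap (o + k) M′)) (map (onEdge (gap o k)) O ++ x ∷ A)
                    ≡ map (onEdge (gap o (k + M′))) O ++ x ∷ A
    outer-eq M′ = trans (List.map-++ (onEdge (gap (o + k) M′)) (map (onEdge (gap o k)) O) (x ∷ A))
      (cong₂ _++_ (gap-edges-gap (m≤m+n o k) ≤-refl O)
                  (cong₂ _∷_ (cong₂ _,_ (gap-< (<-≤-trans parent<first (m≤m+n o k))) (gap-< (m<m+n o (size>0 s))))
                             (gap-edgesFrom-below s ≤-refl)))
    edges-eq : ∀ ss′ → map (onEdge (gap o (k + sizes ss′))) O ++ x ∷ A ++ childEdges r (o + k) ss′
                     ≡ map (onEdge (gap (o + k) (sizes ss′))) (map (onEdge (gap o k)) O ++ x ∷ A) ++ childEdges r (o + k) ss′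
    edges-eq ss′ = trans (sym (List.++-assoc (map (onEdge (gap o (k + sizes ss′))) O) (x ∷ A) _))
                         (cong (_++ childEdges r (o + k) ss′) (sym (outer-eq (sizes ss′))))

module _ {ctx r o O B} (C : Context ctx r o O B) (ss : List RTree) where
  open Context C
  private
    M = sizes ss
    x = (r , o)

  descend : Context (λ us → ctx (node us ∷ ss)) o (suc o)
                    (map (onEdge (gap o (suc M))) O ++ x ∷ childEdges r (suc o) ss) (B + suc M)
  descend = record
    { edges-ctx    = edges-eq
    ; size-ctx     = λ us → trans (size-ctx (node us ∷ ss)) (size-eq (sizes us))
    ; parent<first = ≤-refl
    ; first≤base   = ≤-trans (s≤s (≤-trans first≤base (m≤m+n B M))) (≤-reflexive (sym (+-suc B M)))
    }
    where
    size-eq : ∀ U → B + (suc U + M) ≡ B + suc M + U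
    size-eq U = trans (cong (λ w → B + suc w) (+-comm U M)) (sym (+-assoc B (suc M) U))
    outer-eq : ∀ U → map (onEdge (gap (suc o) U)) (map (onEdge (gap o (suc M))) O ++ x ∷ childEdges r (suc o) ss)
                   ≡ map (onEdge (gap o (suc U + M))) O ++ x ∷ childEdges r (o + suc U) ss
    outer-eq U = trans (List.map-++ (onEdge (gap (suc o) U)) (map (onEdge (gap o (suc M))) O) _)
      (cong₂ _++_ (trans (gap-edges-gap (n≤1+n o) (≤-trans (s≤s (m≤m+n o M)) (≤-reflexive (sym (+-suc o M)))) O)
                         (cong (λ w → map (onEdge (gap o (suc w))) O) (+-comm M U)))
                  (cong₂ _∷_ (cong₂ _,_ (gap-< (≤-trans parent<first (n≤1+n o))) (gap-< ≤-refl))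
                             (trans (gap-childEdges ss (≤-trans parent<first (n≤1+n o)) ≤-refl)
                                    (cong (λ w → childEdges r w ss) (sym (+-suc o U))))))
    edges-eq : ∀ us → edges (ctx (node us ∷ ss)) ↭
               map (onEdge (gap (suc o) (sizes us))) (map (onEdge (gap o (suc M))) O ++ x ∷ childEdges r (suc o) ss)
               ++ childEdges o (suc o) us
    edges-eq us = begin
      edges (ctx (node us ∷ ss))                 ↭⟨ edges-ctx (node us ∷ ss) ⟩
      ρ ++ x ∷ (childEdges o (suc o) us ++ Cs)   ↭⟨ ↭.++⁺ˡ ρ (↭-prep x (↭.++-comm (childEdges o (suc o) us) Cs)) ⟩
      ρ ++ x ∷ (Cs ++ childEdges o (suc o) us)   ≡⟨ List.++-assoc ρ (x ∷ Cs) _ ⟨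
      (ρ ++ x ∷ Cs) ++ childEdges o (suc o) us   ≡⟨ cong (_++ childEdges o (suc o) us) (outer-eq (sizes us)) ⟨
      _ ∎
      where
      open PermutationReasoning
      ρ  = map (onEdge (gap o (suc (sizes us) + M))) O
      Cs = childEdges r (o + suc (sizes us)) ss

cutsL-cuts : ∀ ts {ctx r o O B} → Context ctx r o O B →
             Σ (List (Cut (ctx ts))) λ cs → map Cut.pieces cs ≡ cutsL ts ctx × map Cut.offset cs ≡ range o (sizes ts)
cutsL-cuts []             C = [] , refl , refl
cutsL-cuts (node us ∷ ss) {o = o} C with cutsL-cuts us (descend C ss) | cutsL-cuts ss (next-sibling C (node us) ss)
... | inner , inner-pieces , inner-offsets | later , later-pieces , later-offsets =
  first-cut C (node us) ss ∷ inner ++ later ,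
  cong (_ ∷_) (trans (List.map-++ Cut.pieces inner later) (cong₂ _++_ inner-pieces later-pieces)) ,
  cong (o ∷_) (begin
    map Cut.offset (inner ++ later)                   ≡⟨ List.map-++ Cut.offset inner later ⟩
    map Cut.offset inner ++ map Cut.offset later      ≡⟨ cong₂ _++_ inner-offsets later-offsets ⟩
    range (suc o) U ++ range (o + suc U) (sizes ss)   ≡⟨ cong (λ a → range (suc o) U ++ range a (sizes ss)) (+-suc o U) ⟩
    range (suc o) U ++ range (suc o + U) (sizes ss)   ≡⟨ range-++ (suc o) U (sizes ss) ⟨
    range (suc o) (U + sizes ss)                      ∎)
  where
  open ≡-Reasoning
  U = sizes us

tree-cuts : ∀ t → Σ (List (Cut t)) λ cs → map Cut.pieces cs ≡ cuts t × map Cut.offset cs ≡ range 1 (size t ∸ 1)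
tree-cuts (node ts) = cutsL-cuts ts record
  { edges-ctx = λ _ → ↭-reflexive refl ; size-ctx = λ _ → refl ; parent<first = s≤s z≤n ; first≤base = ≤-refl }

Adjacent : ℕ → ℕ → List Edge → Set
Adjacent a b L = (a , b) ∈ L ⊎ (b , a) ∈ L

adjacent-sym : ∀ {a b L} → Adjacent a b L → Adjacent b a L
adjacent-sym = Sum.swap

graph⇔Adjacent : ∀ t {i j : Fin (size t)} {a b} → toℕ i ≡ a → toℕ j ≡ b → T (graph t i j) ⇔ Adjacent a b (edges t)
graph⇔Adjacent t {i} {j} refl refl = mk⇔ to′ from′
  where
  a = toℕ i
  b = toℕ j
  to′ : T (graph t i j) → Adjacent a b (edges t)
  to′ h with find (Any.any⁻ _ (edges t) h)
  ... | (x , y) , e∈ , matches with to (T-∨ {(x ≡ᵇ a) ∧ (y ≡ᵇ b)}) matches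
  ... | inj₁ forward  = let x≡a , y≡b = to T-∧ forward
                        in inj₁ (subst₂ (λ x y → (x , y) ∈ edges t) (≡ᵇ⇒≡ x a x≡a) (≡ᵇ⇒≡ y b y≡b) e∈)
  ... | inj₂ backward = let x≡b , y≡a = to T-∧ backward
                        in inj₂ (subst₂ (λ x y → (x , y) ∈ edges t) (≡ᵇ⇒≡ x b x≡b) (≡ᵇ⇒≡ y a y≡a) e∈)
  from′ : Adjacent a b (edges t) → T (graph t i j)
  from′ (inj₁ e∈) = Any.any⁺ _ (Any.map (λ { refl → from T-∨ (inj₁ (from T-∧ (≡⇒≡ᵇ a a refl , ≡⇒≡ᵇ b b refl))) })
                                        e∈)
  from′ (inj₂ e∈) = Any.any⁺ _ (Any.map (λ { refl → from T-∨ (inj₂ (from T-∧ (≡⇒≡ᵇ b b refl , ≡⇒≡ᵇ a a refl))) })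
                                        e∈)

T-⇔⇒≡ : ∀ {x y} → T x ⇔ T y → x ≡ y
T-⇔⇒≡ x⇔y = ⇔→≡ (⇔-trans (⇔-sym T-≡) (⇔-trans x⇔y T-≡))

module CutAnalysis {t : RTree} (c : Cut t) where
  open Cut c public

  k = size lower

  InLower : ℕ → Set
  InLower = Between offset (offset + k)

  inLower? : ∀ x → Dec (InLower x)
  inLower? x = offset ≤? x ×-dec x <? offset + k

  offset-inLower : InLower offset
  offset-inLower = ≤-refl , m<m+n offset (size>0 lower)

  shift-inLower : ∀ {x} → x < k → InLower (x + offset)
  shift-inLower {x} x<k = m≤n+m offset x , subst (_< offset + k) (+-comm offset x) (+-monoʳ-< offset x<k)

  gap-cases : ∀ x → (x < offset × gap offset k x ≡ x) ⊎ (offset ≤ x × gap offset k x ≡ x + k)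
  gap-cases x = Sum.map (λ x<o → x<o , gap-< x<o) (λ o≤x → o≤x , gap-≥ o≤x) (<-≤-connex x offset)

  gap-∉lower : ∀ x → ¬ InLower (gap offset k x)
  gap-∉lower x (o≤ , <o+k) with gap-cases x
  ... | inj₁ (x<o , eq) = <⇒≱ x<o (subst (offset ≤_) eq o≤)
  ... | inj₂ (o≤x , eq) = <⇒≱ (subst (_< offset + k) eq <o+k) (+-monoˡ-≤ k o≤x)

  gap-injective : ∀ {x y} → gap offset k x ≡ gap offset k y → x ≡ y
  gap-injective {x} {y} eq with gap-cases x | gap-cases y
  ... | inj₁ (_ , ex) | inj₁ (_ , ey) = trans (sym ex) (trans eq ey)
  ... | inj₂ (_ , ex) | inj₂ (_ , ey) = +-cancelʳ-≡ k x y (trans (sym ex) (trans eq ey))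
  ... | inj₁ (x<o , ex) | inj₂ (o≤y , ey) =
    ⊥-elim (<⇒≱ x<o (≤-trans o≤y (≤-trans (m≤m+n y k) (≤-reflexive (sym (trans (sym ex) (trans eq ey)))))))
  ... | inj₂ (o≤x , ex) | inj₁ (y<o , ey) =
    ⊥-elim (<⇒≱ y<o (≤-trans o≤x (≤-trans (m≤m+n x k) (≤-reflexive (trans (sym ex) (trans eq ey))))))

  lower-edge-bounds : ∀ {x y} → (x , y) ∈ edges lower → x < k × y < k
  lower-edge-bounds e∈ = let (_ , x<k) , (_ , y<k) = edgesFrom-between 0 lower e∈ in x<k , y<k

  edge-cases : ∀ {a b} → (a , b) ∈ edges t →
    (∃₂ λ x y → (x , y) ∈ edges upper × gap offset k x ≡ a × gap offset k y ≡ b) ⊎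
    (a ≡ parent × b ≡ offset) ⊎
    (∃₂ λ x y → (x , y) ∈ edges lower × x + offset ≡ a × y + offset ≡ b)
  edge-cases e∈ with ∈-++⁻ (map (onEdge (gap offset k)) (edges upper)) (↭.∈-resp-↭ edges-split e∈)
  ... | inj₁ e∈upper with ∈-map⁻ (onEdge (gap offset k)) e∈upper
  ...   | (x , y) , xy∈ , refl = inj₁ (x , y , xy∈ , refl , refl)
  edge-cases e∈ | inj₂ (here refl) = inj₂ (inj₁ (refl , refl))
  edge-cases e∈ | inj₂ (there e∈lower) with ∈-map⁻ (onEdge (_+ offset)) e∈lower
  ...   | (x , y) , xy∈ , refl = inj₂ (inj₂ (x , y , xy∈ , refl , refl))

  cut-edge∈ : (parent , offset) ∈ edges t
  cut-edge∈ = ↭.∈-resp-↭ (↭-sym edges-split) (∈-++⁺ʳ (map (onEdge (gap offset k)) (edges upper)) (here refl))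

  lower-edge∈ : ∀ {x y} → (x , y) ∈ edges lower → (x + offset , y + offset) ∈ edges t
  lower-edge∈ xy∈ = ↭.∈-resp-↭ (↭-sym edges-split)
    (∈-++⁺ʳ (map (onEdge (gap offset k)) (edges upper)) (there (∈-map⁺ (onEdge (_+ offset)) xy∈)))

  upper-edge∈ : ∀ {x y} → (x , y) ∈ edges upper → (gap offset k x , gap offset k y) ∈ edges t
  upper-edge∈ xy∈ = ↭.∈-resp-↭ (↭-sym edges-split) (∈-++⁺ˡ (∈-map⁺ (onEdge (gap offset k)) xy∈))

  lower-edge∈⁻ : ∀ {a b} → a < k → (a + offset , b + offset) ∈ edges t → (a , b) ∈ edges lower
  lower-edge∈⁻ {a} {b} a<k e∈ with edge-cases e∈
  ... | inj₁ (x , _ , _ , x′≡ , _) = ⊥-elim (gap-∉lower x (subst InLower (sym x′≡) (shift-inLower a<k)))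
  ... | inj₂ (inj₁ (a+o≡r , _)) = ⊥-elim (<⇒≱ parent<offset (subst (offset ≤_) a+o≡r (m≤n+m offset a)))
  ... | inj₂ (inj₂ (x , y , xy∈ , x≡ , y≡)) =
    subst (_∈ edges lower) (cong₂ _,_ (+-cancelʳ-≡ offset x a x≡) (+-cancelʳ-≡ offset y b y≡)) xy∈

  upper-edge∈⁻ : ∀ {a b} → (gap offset k a , gap offset k b) ∈ edges t → (a , b) ∈ edges upper
  upper-edge∈⁻ {a} {b} e∈ with edge-cases e∈
  ... | inj₁ (x , y , xy∈ , x≡ , y≡) = subst (_∈ edges upper) (cong₂ _,_ (gap-injective x≡) (gap-injective y≡)) xy∈
  ... | inj₂ (inj₁ (_ , b′≡o)) = ⊥-elim (gap-∉lower b (subst InLower (sym b′≡o) offset-inLower))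
  ... | inj₂ (inj₂ (x , _ , xy∈ , x≡ , _)) =
    ⊥-elim (gap-∉lower a (subst InLower x≡ (shift-inLower (proj₁ (lower-edge-bounds xy∈)))))

  crossing-edge : ∀ {x y} → Adjacent x y (edges t) → InLower x → ¬ InLower y → x ≡ offset × y ≡ parent
  crossing-edge (inj₁ e∈) x-in y-out with edge-cases e∈
  ... | inj₁ (x′ , _ , _ , x≡ , _) = ⊥-elim (gap-∉lower x′ (subst InLower (sym x≡) x-in))
  ... | inj₂ (inj₁ (x≡r , _)) = ⊥-elim (<⇒≱ parent<offset (subst (offset ≤_) x≡r (proj₁ x-in)))
  ... | inj₂ (inj₂ (_ , y′ , xy∈ , _ , y≡)) = ⊥-elim (y-out (subst InLower y≡ (shift-inLower (proj₂ (lower-edge-bounds xy∈)))))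
  crossing-edge (inj₂ e∈) x-in y-out with edge-cases e∈
  ... | inj₁ (_ , y′ , _ , _ , y≡) = ⊥-elim (gap-∉lower y′ (subst InLower (sym y≡) x-in))
  ... | inj₂ (inj₁ (y≡r , x≡o)) = x≡o , y≡r
  ... | inj₂ (inj₂ (x′ , _ , xy∈ , x≡ , _)) = ⊥-elim (y-out (subst InLower x≡ (shift-inLower (proj₁ (lower-edge-bounds xy∈)))))

  lower-adjacent : ∀ {a b} → a < k → b < k → Adjacent a b (edges lower) ⇔ Adjacent (a + offset) (b + offset) (edges t)
  lower-adjacent a<k b<k = mk⇔ (Sum.map lower-edge∈ lower-edge∈) (Sum.map (lower-edge∈⁻ a<k) (lower-edge∈⁻ b<k))

  upper-adjacent : ∀ {a b} → Adjacent a b (edges upper) ⇔ Adjacent (gap offset k a) (gap offset k b) (edges t)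
  upper-adjacent = mk⇔ (Sum.map upper-edge∈ upper-edge∈) (Sum.map upper-edge∈⁻ upper-edge∈⁻)

  upper-onto : ∀ {x} → x < size t → ¬ InLower x → ∃ λ y → y < size upper × gap offset k y ≡ x
  upper-onto {x} x<n x-out with <-≤-connex x offset
  ... | inj₁ x<o = x , <-≤-trans x<o offset≤upper , gap-< x<o
    where
    offset≤upper : offset ≤ size upper
    offset≤upper = +-cancelʳ-≤ k offset (size upper) (subst (offset + k ≤_) (trans (sym size-sum) (+-comm k (size upper))) lower-fits)
  ... | inj₂ o≤x = x ∸ k , x∸k<upper , trans (gap-≥ o≤x∸k) (m∸n+n≡m k≤x)
    where
    o+k≤x : offset + k ≤ x
    o+k≤x = ≮⇒≥ (x-out ∘ (o≤x ,_))
    k≤x : k ≤ x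
    k≤x = ≤-trans (m≤n+m k offset) o+k≤x
    o≤x∸k : offset ≤ x ∸ k
    o≤x∸k = subst (_≤ x ∸ k) (m+n∸n≡m offset k) (∸-monoˡ-≤ k o+k≤x)
    x∸k<upper : x ∸ k < size upper
    x∸k<upper = subst (x ∸ k <_) (trans (cong (_∸ k) (sym size-sum)) (m+n∸m≡n k (size upper))) (∸-monoˡ-< x<n k≤x)

  lower-onto : ∀ {x} → InLower x → ∃ λ y → y < k × y + offset ≡ x
  lower-onto {x} (o≤x , x<o+k) = x ∸ offset , subst (x ∸ offset <_) (m+n∸m≡n offset k) (∸-monoˡ-< x<o+k o≤x) , m∸n+n≡m o≤x

  lower-vertex : Fin k → Fin (size t)
  lower-vertex a = fromℕ< (<-≤-trans (subst (_< offset + k) (+-comm offset (toℕ a)) (+-monoʳ-< offset (toℕ<n a))) lower-fits)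

  toℕ-lower-vertex : ∀ a → toℕ (lower-vertex a) ≡ toℕ a + offset
  toℕ-lower-vertex a = toℕ-fromℕ< _

  upper-vertex : Fin (size upper) → Fin (size t)
  upper-vertex b = fromℕ< (upper-label< (toℕ b) (toℕ<n b))
    where
    upper-label< : ∀ y → y < size upper → gap offset k y < size t
    upper-label< y y<m with gap-cases y
    ... | inj₁ (y<o , eq) = subst (_< size t) (sym eq) (<-trans y<o (<-≤-trans (m<m+n offset (size>0 lower)) lower-fits))
    ... | inj₂ (_ , eq)   = subst (_< size t) (sym eq) (subst (y + k <_) (trans (+-comm (size upper) k) size-sum) (+-monoˡ-< k y<m))

  toℕ-upper-vertex : ∀ b → toℕ (upper-vertex b) ≡ gap offset k (toℕ b)
  toℕ-upper-vertex b = toℕ-fromℕ< _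

  toSplit : Split (graph t)
  toSplit = record
    { m₁ = k ; m₂ = size upper ; G₁ = graph lower ; G₂ = graph upper
    ; φ₁ = lower-vertex ; φ₂ = upper-vertex
    ; φ₁-injective = λ {a} {b} eq → toℕ-injective (+-cancelʳ-≡ offset (toℕ a) (toℕ b)
        (trans (sym (toℕ-lower-vertex a)) (trans (cong toℕ eq) (toℕ-lower-vertex b))))
    ; φ₂-injective = λ {a} {b} eq → toℕ-injective (gap-injective
        (trans (sym (toℕ-upper-vertex a)) (trans (cong toℕ eq) (toℕ-upper-vertex b))))
    ; induced₁ = λ i j → T-⇔⇒≡ (⇔-trans (graph⇔Adjacent lower refl refl) (⇔-trans (lower-adjacent (toℕ<n i) (toℕ<n j))
        (⇔-sym (graph⇔Adjacent t (toℕ-lower-vertex i) (toℕ-lower-vertex j)))))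
    ; induced₂ = λ i j → T-⇔⇒≡ (⇔-trans (graph⇔Adjacent upper refl refl) (⇔-trans upper-adjacent
        (⇔-sym (graph⇔Adjacent t (toℕ-upper-vertex i) (toℕ-upper-vertex j)))))
    ; apart = λ a b eq → gap-∉lower (toℕ b)
        (subst InLower (trans (sym (toℕ-lower-vertex a)) (trans (cong toℕ eq) (toℕ-upper-vertex b)))
               (shift-inLower (toℕ<n a)))
    ; cover = cover
    ; point₁ = root lower
    ; point₂ = root upper
    }
    where
    cover : ∀ j → (∃ λ a → lower-vertex a ≡ j) ⊎ (∃ λ b → upper-vertex b ≡ j)
    cover j with inLower? (toℕ j)
    ... | yes j-in  = let y , y<k , y+o≡j = lower-onto j-in in
      inj₁ (fromℕ< y<k , toℕ-injective (trans (toℕ-lower-vertex _) (trans (cong (_+ offset) (toℕ-fromℕ< y<k)) y+o≡j)))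
    ... | no  j-out = let y , y<m , gap≡j = upper-onto (toℕ<n j) j-out in
      inj₂ (fromℕ< y<m , toℕ-injective (trans (toℕ-upper-vertex _) (trans (cong (gap offset k) (toℕ-fromℕ< y<m)) gap≡j)))

  open Split toSplit using (side₁; side₂; sides-bipartition; module E₁)

  parent-vertex : Fin (size t)
  parent-vertex = fromℕ< (<-trans parent<offset (<-≤-trans (m<m+n offset (size>0 lower)) lower-fits))

  toℕ-parent-vertex : toℕ parent-vertex ≡ parent
  toℕ-parent-vertex = toℕ-fromℕ< _

  offset-vertex : Fin (size t)
  offset-vertex = lower-vertex (root lower)

  toℕ-offset-vertex : toℕ offset-vertex ≡ offset
  toℕ-offset-vertex = trans (toℕ-lower-vertex (root lower)) (cong (_+ offset) (toℕ-root lower))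

  0-∉lower : ¬ InLower 0
  0-∉lower (o≤0 , _) = <⇒≱ (≤-<-trans z≤n parent<offset) o≤0

  ∈side₁⇒inLower : ∀ {j} → j ∈ₛ side₁ → InLower (toℕ j)
  ∈side₁⇒inLower {j} j∈ with E₁.∈-image⁻ full j∈
  ... | a , _ , refl = subst InLower (sym (toℕ-lower-vertex a)) (shift-inLower (toℕ<n a))

  inLower⇒∈side₁ : ∀ {j} → InLower (toℕ j) → j ∈ₛ side₁
  inLower⇒∈side₁ {j} j-in with lower-onto j-in
  ... | y , y<k , y+o≡j = subst (_∈ₛ side₁) (toℕ-injective toℕ≡) (E₁.∈-image⁺ ∈⊤)
    where
    toℕ≡ : toℕ (lower-vertex (fromℕ< y<k)) ≡ toℕ j
    toℕ≡ = trans (toℕ-lower-vertex _) (trans (cong (_+ offset) (toℕ-fromℕ< y<k)) y+o≡j)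

  ∉lower⇒∈side₂ : ∀ {j} → ¬ InLower (toℕ j) → j ∈ₛ side₂
  ∉lower⇒∈side₂ {j} j-out = [ ⊥-elim ∘ j-out ∘ ∈side₁⇒inLower , id ]′ (bipartition-cover sides-bipartition j)

  offset-vertex∈side₁ : offset-vertex ∈ₛ side₁
  offset-vertex∈side₁ = inLower⇒∈side₁ (subst InLower (sym toℕ-offset-vertex) offset-inLower)

  root∉side₁ : root t ∉ₛ side₁
  root∉side₁ = 0-∉lower ∘ subst InLower (toℕ-root t) ∘ ∈side₁⇒inLower

  root∈side₂ : root t ∈ₛ side₂
  root∈side₂ = ∉lower⇒∈side₂ (0-∉lower ∘ subst InLower (toℕ-root t))

same-split⇒same-offset : ∀ {t} (c c′ : Cut t) → SameSplit (CutAnalysis.toSplit c) (CutAnalysis.toSplit c′) →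
                         Cut.offset c ≡ Cut.offset c′
same-split⇒same-offset c c′ (inj₁ (side₁≡side₁′ , _)) =
  ≤-antisym (offset≤ c c′ side₁≡side₁′) (offset≤ c′ c (sym side₁≡side₁′))
  where
  offset≤ : ∀ c c′ → Split.side₁ (CutAnalysis.toSplit c) ≡ Split.side₁ (CutAnalysis.toSplit c′) →
            Cut.offset c ≤ Cut.offset c′
  offset≤ c c′ eq = subst (Cut.offset c ≤_) (CutAnalysis.toℕ-offset-vertex c′)
    (proj₁ (CutAnalysis.∈side₁⇒inLower c (subst (_ ∈ₛ_) (sym eq) (CutAnalysis.offset-vertex∈side₁ c′))))
same-split⇒same-offset c c′ (inj₂ (side₁≡side₂′ , _)) =
  ⊥-elim (CutAnalysis.root∉side₁ c (subst (_ ∈ₛ_) (sym side₁≡side₂′) (CutAnalysis.root∈side₂ c′)))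

-- Counting binary tubings of a tree by its edges

module TreeCuts (t : RTree) where
  open CutAnalysis using (toSplit)

  cs : List (Cut t)
  cs = proj₁ (tree-cuts t)

  cut-with-offset : ∀ {v} → 0 < v → v < size t → ∃ λ c → c ∈ cs × Cut.offset c ≡ v
  cut-with-offset {v} 0<v v<n with ∈-map⁻ Cut.offset (subst (v ∈_) (sym (proj₂ (proj₂ (tree-cuts t)))) v∈range)
    where
    v∈range : v ∈ range 1 (size t ∸ 1)
    v∈range = ∈-range⁺ (0<v , subst (v <_) (sym (m+[n∸m]≡n (size>0 t))) v<n)
  ... | c , c∈ , v≡ = c , c∈ , sym v≡

  tree-connected : Connected (graph t) full
  tree-connected = connected-by-descent (toℕ-root t) symmetric descent
    where
    symmetric : ∀ i j → graph t i j ≡ graph t j i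
    symmetric i j = T-⇔⇒≡ (⇔-trans (graph⇔Adjacent t refl refl)
                     (⇔-trans (mk⇔ adjacent-sym adjacent-sym) (⇔-sym (graph⇔Adjacent t refl refl))))
    descent : ∀ v → 0 < toℕ v → ∃ λ p → toℕ p < toℕ v × T (graph t p v)
    descent v 0<v with cut-with-offset 0<v (toℕ<n v)
    ... | c , _ , offset≡v = parent-vertex , subst₂ _<_ (sym toℕ-parent-vertex) offset≡v parent<offset ,
                             from (graph⇔Adjacent t toℕ-parent-vertex (sym offset≡v)) (inj₁ cut-edge∈)
      where open CutAnalysis c

  splits-distinct : AllPairs (λ c c′ → ¬ SameSplit c c′) (map toSplit cs)
  splits-distinct = AllPairs.map⁺ (AllPairs.map (λ {c} {c′} offset≢ same → offset≢ (same-split⇒same-offset c c′ same))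
    (AllPairs.map⁻ (subst Unique (sym (proj₂ (proj₂ (tree-cuts t)))) (Unique-range 1 (size t ∸ 1)))))

  -- With the root in A, the least vertex v of B is the offset of a cut, and B is the lower side:
  -- a path in B leaving the lower side would pass through the parent of v, a smaller label.
  lower-side-of-bipartition : ∀ {A B} → Tube (graph t) A → Tube (graph t) B → IsBipartition A B → root t ∈ₛ A →
                              ∃ λ c → c ∈ cs × Split.SplitsAs (toSplit c) A B
  lower-side-of-bipartition {A} {B} (_ , A-connected) (B≠∅ , B-connected) A∣B root∈A
    with least-element B≠∅
  ... | v , v∈B , below-v-∉B with cut-with-offset 0<v (toℕ<n v)
    where
    0<v : 0 < toℕ v
    0<v = n≢0⇒n>0 λ v≡0 → proj₁ A∣B root∈A (subst (_∈ₛ B) (toℕ-injective (trans v≡0 (sym (toℕ-root t)))) v∈B)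
  ... | c , c∈ , offset≡v = c , c∈ , inj₂ (A≡side₂ , B≡side₁)
    where
    open CutAnalysis c hiding (toSplit)
    open Split (toSplit c) using (side₁; side₂; sides-bipartition)
    offset-vertex≡v : offset-vertex ≡ v
    offset-vertex≡v = toℕ-injective (trans toℕ-offset-vertex offset≡v)
    only-exit : ∀ {i j} → T (graph t i j) → i ∈ₛ side₁ → j ∉ₛ side₁ → i ≡ offset-vertex × j ≡ parent-vertex
    only-exit Gij i∈ j∉ with crossing-edge (to (graph⇔Adjacent t refl refl) Gij) (∈side₁⇒inLower i∈) (j∉ ∘ inLower⇒∈side₁)
    ... | i≡o , j≡r = toℕ-injective (trans i≡o (sym toℕ-offset-vertex)) , toℕ-injective (trans j≡r (sym toℕ-parent-vertex))
    v∈side₁ : v ∈ₛ side₁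
    v∈side₁ = subst (_∈ₛ side₁) offset-vertex≡v offset-vertex∈side₁
    B⊆side₁ : B ⊆ side₁
    B⊆side₁ {y} y∈B = decidable-stable (y ∈? side₁) λ y∉ →
      below-v-∉B (subst₂ _<_ (sym toℕ-parent-vertex) offset≡v parent<offset)
                 (proj₂ (connected-crossing B-connected only-exit v∈B y∈B v∈side₁ y∉))
    side₁⊆B : side₁ ⊆ B
    side₁⊆B {y} y∈ = decidable-stable (y ∈? B) λ y∉B →
      let y∈A = [ id , ⊥-elim ∘ y∉B ]′ (bipartition-cover A∣B y)
      in proj₁ A∣B (proj₁ (connected-crossing A-connected only-exit y∈A root∈A y∈ root∉side₁))
                   (subst (_∈ₛ B) (sym offset-vertex≡v) v∈B)
    B≡side₁ : B ≡ side₁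
    B≡side₁ = ⊆-antisym B⊆side₁ side₁⊆B
    A≡side₂ : A ≡ side₂
    A≡side₂ = complement-unique (subst (λ B → IsBipartition B A) B≡side₁ (bipartition-sym A∣B)) sides-bipartition

  splits-complete : ∀ {A B} → Tube (graph t) A → Tube (graph t) B → IsBipartition A B →
                    Any (λ c → Split.SplitsAs c A B) (map toSplit cs)
  splits-complete {A} {B} A-tube B-tube A∣B with bipartition-cover A∣B (root t)
  ... | inj₁ root∈A = let c , c∈ , splits = lower-side-of-bipartition A-tube B-tube A∣B root∈A
                      in Any.map⁺ (lose c∈ splits)
  ... | inj₂ root∈B = let c , c∈ , splits = lower-side-of-bipartition B-tube A-tube (bipartition-sym A∣B) root∈B
                      in Any.map⁺ (lose c∈ (Split.splitsAs-sym (toSplit c) splits))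

  N-by-cuts : 2 ≤ size t → N t ≡ sum (map (λ p → N (proj₁ p) * N (proj₂ p)) (cuts t))
  N-by-cuts 2≤n = begin
    N t                                     ≡⟨ NG≡length-tubings (size t) (graph t) ⟩
    length (tubings (size t) (graph t))     ≡⟨ Splitting.length-tubings-by-splits tree-connected (full-nontrivial 2≤n)
                                                 (map toSplit cs) splits-distinct splits-complete ⟩
    sum (map count (map toSplit cs))        ≡⟨ cong sum (List.map-∘ cs) ⟨
    sum (map (count ∘ toSplit) cs)          ≡⟨ cong sum (List.map-cong N-pieces cs) ⟨
    sum (map (product ∘ Cut.pieces) cs)     ≡⟨ cong sum (List.map-∘ cs) ⟩
    sum (map product (map Cut.pieces cs))   ≡⟨ cong (sum ∘ map product) (proj₁ (proj₂ (tree-cuts t))) ⟩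
    sum (map product (cuts t))              ∎
    where
    open ≡-Reasoning
    count : Split (graph t) → ℕ
    count c = length (tubings (Split.m₁ c) (Split.G₁ c)) * length (tubings (Split.m₂ c) (Split.G₂ c))
    product : RTree × RTree → ℕ
    product p = N (proj₁ p) * N (proj₂ p)
    N-pieces : ∀ c → product (Cut.pieces c) ≡ count (toSplit c)
    N-pieces c = cong₂ _*_ (NG≡length-tubings _ (graph (Cut.lower c))) (NG≡length-tubings _ (graph (Cut.upper c)))

lemma2p9 : ((t : RTree) → 2 ≤ size t →
    N t ≡ sum (map (λ p → N (proj₁ p) * N (proj₂ p)) (cuts t)))
    × ((t₁ t₂ : RTree) → UnderlyingIso t₁ t₂ → N t₁ ≡ N t₂)
lemma2p9 = TreeCuts.N-by-cuts , λ t₁ t₂ (f , preserves) → NG-invariant f (graph t₁) (graph t₂) preserves
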